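{- If $T$ is a $k$-metric dimensional tree which is not a path, then $k=\varsigma(T)$.
   Context: For a connected graph $G$ with shortest-path distance $d_G$: a vertex $w$ distinguishes $x,y$ if $d_G(x,w)\ne d_G(y,w)$; a set $S$ is a $k$-metric generator if every pair of distinct vertices is distinguished by at least $k$ elements of $S$; $G$ is $k$-metric dimensional if $k$ is the largest integer for which a $k$-metric generator exists. A major vertex has degree at least $3$. A degree-one vertex $u$ is a terminal vertex of a major vertex $v$ if $d_G(u,v)<d_G(u,w)$ for every other major vertex $w$; $\operatorname{ter}(v)$ is the number of terminal vertices of $v$; $\mathcal{M}(G)$ is the set of major vertices with $\operatorname{ter}(v)>1$. For $w\in\mathcal{M}(G)$ and distinct terminal vertices $u_j,u_r$ of $w$, $\varsigma(u_j,u_r)$ is the length of a shortest $u_j$–$u_r$ path containing $w$; $\varsigma(w)$ is the minimum of $\varsigma(u_j,u_r)$ over distinct terminal vertices of $w$; $\varsigma(G)=\min_{w\in\mathcal{M}(G)}\varsigma(w)$. -}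

module Defs where

open import Data.Nat using (ℕ; zero; suc; _≤_; _<_)
open import Data.Fin using (Fin; zero; suc; toℕ; fromℕ; inject₁)
open import Data.Fin.Subset using (Subset; _∈_)
open import Data.Bool using (Bool; true)
open import Data.Product using (Σ; ∃; ∃-syntax; _×_; _,_)
open import Data.Sum using (_⊎_)
open import Relation.Nullary using (¬_)
open import Relation.Binary.PropositionalEquality using (_≡_; _≢_)
open import Function.Definitions using (Injective)
open import Function.Bundles using (_↔_; Inverse)

record Graph (n : ℕ) : Set where
  field
    adj     : Fin n → Fin n → Bool
    adj-sym : ∀ x y → adj x y ≡ true → adj y x ≡ true
    irrefl  : ∀ x → ¬ (adj x x ≡ true)

open Graph public

module _ {n : ℕ} (G : Graph n) where

  IsWalk : (m : ℕ) → (Fin (suc m) → Fin n) → Fin n → Fin n → Set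
  IsWalk m p x y =
    (p zero ≡ x) × (p (fromℕ m) ≡ y) ×
    (∀ (i : Fin m) → adj G (p (inject₁ i)) (p (suc i)) ≡ true)

  IsPath : (m : ℕ) → (Fin (suc m) → Fin n) → Fin n → Fin n → Set
  IsPath m p x y = IsWalk m p x y × Injective _≡_ _≡_ p

  HasWalkOfLength : Fin n → Fin n → ℕ → Set
  HasWalkOfLength x y m = Σ (Fin (suc m) → Fin n) λ p → IsWalk m p x y

  IsMin : (ℕ → Set) → ℕ → Set
  IsMin P m = P m × (∀ l → P l → m ≤ l)

  Dist : Fin n → Fin n → ℕ → Set
  Dist x y m = IsMin (HasWalkOfLength x y) m

  Connected : Set
  Connected = ∀ x y → ∃[ m ] HasWalkOfLength x y m

  -- A cycle: path x .. y on at least 3 vertices together with the edge y x.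
  HasCycle : Set
  HasCycle = ∃[ m ] (2 ≤ m × Σ (Fin (suc m) → Fin n) λ p → ∃[ x ] ∃[ y ]
               (IsPath m p x y × adj G y x ≡ true))

  IsTree : Set
  IsTree = Connected × ¬ HasCycle

  IsPathGraph : Set
  IsPathGraph = Σ (Fin n ↔ Fin n) λ σ → ∀ i j →
    (adj G (Inverse.to σ i) (Inverse.to σ j) ≡ true
       → (toℕ j ≡ suc (toℕ i) ⊎ toℕ i ≡ suc (toℕ j))) ×
    ((toℕ j ≡ suc (toℕ i) ⊎ toℕ i ≡ suc (toℕ j))
       → adj G (Inverse.to σ i) (Inverse.to σ j) ≡ true)

  Distinguishes : Fin n → Fin n → Fin n → Set
  Distinguishes w x y = ∃[ a ] ∃[ b ] (Dist x w a × Dist y w b × a ≢ b)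

  IsKMetricGenerator : ℕ → Subset n → Set
  IsKMetricGenerator k S = ∀ x y → x ≢ y →
    Σ (Fin k → Fin n) λ f → Injective _≡_ _≡_ f ×
      (∀ i → (f i ∈ S) × Distinguishes (f i) x y)

  IsKMetricDimensional : ℕ → Set
  IsKMetricDimensional k =
    (∃[ S ] IsKMetricGenerator k S) ×
    (∀ k' → ∃[ S ] IsKMetricGenerator k' S → k' ≤ k)

  -- Degree at least 3.
  IsMajor : Fin n → Set
  IsMajor v = ∃[ a ] ∃[ b ] ∃[ c ]
    (adj G v a ≡ true × adj G v b ≡ true × adj G v c ≡ true ×
     a ≢ b × a ≢ c × b ≢ c)

  HasDegreeOne : Fin n → Set
  HasDegreeOne u = ∃[ z ] (adj G u z ≡ true × (∀ z' → adj G u z' ≡ true → z' ≡ z))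

  IsTerminal : Fin n → Fin n → Set
  IsTerminal u v = IsMajor v × HasDegreeOne u ×
    (∀ w → IsMajor w → w ≢ v → ∀ a b → Dist u v a → Dist u w b → a < b)

  -- v ∈ 𝓜(G): major vertex with ter(v) > 1.
  InM : Fin n → Set
  InM v = IsMajor v × ∃[ u ] ∃[ u' ] (u ≢ u' × IsTerminal u v × IsTerminal u' v)

  PathThroughOfLength : Fin n → Fin n → Fin n → ℕ → Set
  PathThroughOfLength u u' w l =
    Σ (Fin (suc l) → Fin n) λ p → IsPath l p u u' × ∃[ i ] p i ≡ w

  VarsigmaPair : Fin n → Fin n → Fin n → ℕ → Set
  VarsigmaPair u u' w m = IsMin (PathThroughOfLength u u' w) m

  VarsigmaVertex : Fin n → ℕ → Set
  VarsigmaVertex w m = IsMin (λ l → ∃[ u ] ∃[ u' ]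
    (u ≢ u' × IsTerminal u w × IsTerminal u' w × VarsigmaPair u u' w l)) m

  Varsigma : ℕ → Set
  Varsigma m = IsMin (λ l → ∃[ w ] (InM w × VarsigmaVertex w l)) m

module Submission where

-- A leg of a vertex e is a pendant path e – ℓ 0 – … – ℓ s whose vertices
-- have degree two except the leaf ℓ s; a fork is a major vertex with two legs
-- whose leaves differ, and its span is the distance between these leaves.
-- The leaves of a fork are terminal vertices of its centre, and conversely
-- the shortest walk from a major vertex to one of its terminal vertices is
-- a leg, so terminal pairs and forks correspond, with ς(u, u′) = span.
-- Upper bound: in a fork whose first leg is the shorter one, the two leg
-- vertices at the depth of its leaf are resolved only by leg vertices, so
-- k ≤ span of every fork.  Lower bound: for x ≠ y, cut a shortest x–y walk
-- in its middle; the sides of the cut are closer to x resp. to y, and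
-- descending into a side finds a fork inside it or shows it is one leg.
-- Two legs cannot make up the whole tree (T is not a path), so some fork
-- has all its leg vertices resolving x and y.  If every fork spanned more
-- than k, all vertices would form a (k + 1)-metric generator; hence some
-- terminal pair has ς-value exactly k, the minimum.

open import Defs
open import Data.Nat using (ℕ; zero; suc; _+_; _∸_; _≤_; _<_; z≤n; s≤s; s≤s⁻¹; _≤?_; _<?_)
open import Data.Nat.Properties
open import Data.Fin as F using (Fin; zero; suc; toℕ; fromℕ<; inject₁)
import Data.Fin.Properties as FP
open import Data.Bool using (true)
import Data.Bool.Properties as BP
open import Data.Product using (Σ; ∃-syntax; _×_; _,_; proj₁; proj₂)
open import Data.Sum using (_⊎_; inj₁; inj₂)
open import Data.Empty using (⊥; ⊥-elim)
open import Relation.Nullary using (¬_; Dec; yes; no)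
open import Relation.Nullary.Decidable using (_×-dec_; _→-dec_; ¬?)
open import Relation.Binary.PropositionalEquality
open import Function.Definitions using (Injective)
open import Function.Bundles using (mk↔ₛ′)
open import Data.Fin.Subset using (⊤)
open import Data.Fin.Subset.Properties using (∈⊤)

IsLeast : (ℕ → Set) → ℕ → Set
IsLeast P m = P m × (∀ l → P l → m ≤ l)

-- A decidable predicate with some witness has a least witness: scan
-- i = 0, 1, … with k = m ∸ i bounding the remaining search.
least : (P : ℕ → Set) → (∀ l → Dec (P l)) → ∀ m → P m → Σ ℕ (IsLeast P)
least P P? m pm = search m 0 refl (λ j ())
  where
  search : ∀ k i → i + k ≡ m → (∀ j → j < i → ¬ P j) → Σ ℕ (IsLeast P)
  search k i eq below with P? i
  ... | yes pi = i , pi , λ l pl → ≮⇒≥ (λ l<i → below l l<i pl)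
  search zero i eq below | no ¬pi = ⊥-elim (¬pi (subst P (trans (sym eq) (+-identityʳ i)) pm))
  search (suc k) i eq below | no ¬pi = search k (suc i) (trans (sym (+-suc i k)) eq) below′
    where
    below′ : ∀ j → j < suc i → ¬ P j
    below′ j (s≤s j≤i) with m≤n⇒m<n∨m≡n j≤i
    ... | inj₁ j<i = below j j<i
    ... | inj₂ refl = ¬pi

least-unique : ∀ {P : ℕ → Set} {a b} → IsLeast P a → IsLeast P b → a ≡ b
least-unique (pa , ma) (pb , mb) = ≤-antisym (ma _ pb) (mb _ pa)

squeeze : ∀ {a b c e} → a ≤ b → c ≤ e → b + e ≤ a + c → a ≡ b × c ≡ e
squeeze {a} {b} {c} {e} a≤b c≤e sum≤ = ≤-antisym a≤b b≤a , c≡e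
  where
  c≡e : c ≡ e
  c≡e = ≤-antisym c≤e (+-cancelˡ-≤ b e c (≤-trans sum≤ (+-monoˡ-≤ c a≤b)))
  b≤a : b ≤ a
  b≤a = +-cancelʳ-≤ e b a (subst (λ v → b + e ≤ a + v) c≡e sum≤)

injective-decoded⇒≤ : ∀ {n k} N (dec : ℕ → Fin n) (f : Fin k → Fin n) → Injective _≡_ _≡_ f →
                      (∀ i → Σ ℕ λ j → j < N × dec j ≡ f i) → k ≤ N
injective-decoded⇒≤ N dec f f-inj code = FP.injective⇒≤ {f = index} index-inj
  where
  index : Fin _ → Fin N
  index i = fromℕ< (proj₁ (proj₂ (code i)))
  same-code : ∀ {i j} → index i ≡ index j → proj₁ (code i) ≡ proj₁ (code j)
  same-code {i} {j} eq = trans (sym (FP.toℕ-fromℕ< (proj₁ (proj₂ (code i)))))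
                           (trans (cong toℕ eq) (FP.toℕ-fromℕ< (proj₁ (proj₂ (code j)))))
  index-inj : Injective _≡_ _≡_ index
  index-inj {i} {j} eq = f-inj (trans (sym (proj₂ (proj₂ (code i))))
                                (trans (cong dec (same-code eq)) (proj₂ (proj₂ (code j)))))

splice : ∀ {A : Set} → ℕ → (ℕ → A) → (ℕ → A) → ℕ → A
splice a f g k with k <? a
... | yes _ = f k
... | no _ = g (k ∸ a)

splice-l : ∀ {A : Set} a (f g : ℕ → A) k → k < a → splice a f g k ≡ f k
splice-l a f g k k<a with k <? a
... | yes _ = refl
... | no k≮a = ⊥-elim (k≮a k<a)

splice-r : ∀ {A : Set} a (f g : ℕ → A) k → splice a f g (a + k) ≡ g k
splice-r a f g k with (a + k) <? a
... | yes a+k<a = ⊥-elim (<⇒≱ a+k<a (m≤m+n a k))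
... | no _ = cong g (m+n∸m≡n a k)

split-< : ∀ a k → k < a ⊎ Σ ℕ (λ k′ → k ≡ a + k′)
split-< zero k = inj₂ (k , refl)
split-< (suc a) zero = inj₁ (s≤s z≤n)
split-< (suc a) (suc k) with split-< a k
... | inj₁ k<a = inj₁ (s≤s k<a)
... | inj₂ (k′ , eq) = inj₂ (k′ , cong suc eq)

split-≤ : ∀ a k → k ≤ a ⊎ Σ ℕ (λ k′ → k ≡ a + suc k′)
split-≤ zero zero = inj₁ z≤n
split-≤ zero (suc k) = inj₂ (k , refl)
split-≤ (suc a) zero = inj₁ z≤n
split-≤ (suc a) (suc k) with split-≤ a k
... | inj₁ k≤a = inj₁ (s≤s k≤a)
... | inj₂ (k′ , eq) = inj₂ (k′ , cong suc eq)

2+n≢n : ∀ {i} → suc (suc i) ≢ i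
2+n≢n {i} h = <-irrefl (sym h) (<-trans (n<1+n i) (n<1+n (suc i)))

zeros-or-2≤ : ∀ p q → (p ≡ 0 × q ≡ 0) ⊎ 2 ≤ p + suc q
zeros-or-2≤ zero zero = inj₁ (refl , refl)
zeros-or-2≤ zero (suc q) = inj₂ (s≤s (s≤s z≤n))
zeros-or-2≤ (suc p) q = inj₂ (s≤s (subst (1 ≤_) (sym (+-suc p q)) (s≤s z≤n)))

parity : ∀ m → Σ ℕ λ i → m ≡ i + i ⊎ m ≡ suc (i + i)
parity zero = 0 , inj₁ refl
parity (suc m) with parity m
... | i , inj₁ eq = i , inj₂ (cong suc eq)
... | i , inj₂ eq = suc i , inj₁ (trans (cong suc eq) (cong suc (sym (+-suc i i))))

rev-< : ∀ t k → t ∸ k < suc t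
rev-< t k = s≤s (m∸n≤m t k)

rev-inj : ∀ t i j → i < suc t → j < suc t → t ∸ i ≡ t ∸ j → i ≡ j
rev-inj t i j hi hj eq = trans (sym (m∸[m∸n]≡n (s≤s⁻¹ hi))) (trans (cong (t ∸_) eq) (m∸[m∸n]≡n (s≤s⁻¹ hj)))

rev≡0 : ∀ t k → k < suc t → t ∸ k ≡ 0 → k ≡ t
rev≡0 t k h eq = ≤-antisym (s≤s⁻¹ h) (subst (t ≤_) (+-identityʳ k) (subst (λ v → t ≤ k + v) eq (m≤n+m∸n t k)))

rev≡suc : ∀ t k a → t ∸ k ≡ suc a → suc k < suc t × t ∸ suc k ≡ a
rev≡suc zero zero a ()
rev≡suc zero (suc k) a ()
rev≡suc (suc t) zero a eq = s≤s (s≤s z≤n) , suc-injective eq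
rev≡suc (suc t) (suc k) a eq with rev≡suc t k a eq
... | h , e = s≤s h , e

rev-suc : ∀ t k → k < suc t → suc (t ∸ k) < suc t → Σ ℕ λ k′ → k ≡ suc k′ × t ∸ k′ ≡ suc (t ∸ k)
rev-suc t zero _ h = ⊥-elim (<-irrefl refl (s≤s⁻¹ h))
rev-suc t (suc k) hk h = k , refl , +-∸-assoc 1 (s≤s⁻¹ hk)

clamp : ∀ m → ℕ → Fin (suc m)
clamp m zero = zero
clamp zero (suc k) = zero
clamp (suc m) (suc k) = suc (clamp m k)

clamp-toℕ : ∀ m k → k ≤ m → toℕ (clamp m k) ≡ k
clamp-toℕ m zero _ = refl
clamp-toℕ (suc m) (suc k) (s≤s k≤m) = cong suc (clamp-toℕ m k k≤m)

pigeon3 : ∀ {A : Set} {a b c x y : A} → (a ≡ x ⊎ a ≡ y) → (b ≡ x ⊎ b ≡ y) → (c ≡ x ⊎ c ≡ y) →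
          a ≢ b → a ≢ c → b ≢ c → ⊥
pigeon3 (inj₁ p) (inj₁ q) _ ab _ _ = ab (trans p (sym q))
pigeon3 (inj₂ p) (inj₂ q) _ ab _ _ = ab (trans p (sym q))
pigeon3 (inj₁ p) _ (inj₁ r) _ ac _ = ac (trans p (sym r))
pigeon3 (inj₂ p) _ (inj₂ r) _ ac _ = ac (trans p (sym r))
pigeon3 (inj₁ p) (inj₂ q) (inj₂ r) _ _ bc = bc (trans q (sym r))
pigeon3 (inj₂ p) (inj₁ q) (inj₁ r) _ _ bc = bc (trans q (sym r))

-- Walks, indexed by ℕ rather than by Fin, which makes splicing easy.
module Walks {n : ℕ} (T : Graph n) where

  E : Fin n → Fin n → Set
  E a b = adj T a b ≡ true

  E? : ∀ a b → Dec (E a b)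
  E? a b = adj T a b BP.≟ true

  E-sym : ∀ {a b} → E a b → E b a
  E-sym {a} {b} = adj-sym T a b

  E≢ : ∀ {a b} → E a b → a ≢ b
  E≢ {a} e refl = irrefl T a e

  -- A walk of length m from x to y; the vertices beyond index m are junk.
  record Walk (x y : Fin n) (m : ℕ) : Set where
    constructor mkWalk
    field
      at : ℕ → Fin n
      start : at 0 ≡ x
      end : at m ≡ y
      step : ∀ i → i < m → E (at i) (at (suc i))
  open Walk public

  nilW : ∀ {x} → Walk x x 0
  nilW {x} = mkWalk (λ _ → x) refl refl (λ i ())

  consW : ∀ {x z y m} → E x z → Walk z y m → Walk x y (suc m)
  consW {x} {z} {y} {m} e w = mkWalk vertex refl (end w) steps
    where
    vertex : ℕ → Fin n
    vertex zero = x
    vertex (suc k) = at w k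
    steps : ∀ i → i < suc m → E (vertex i) (vertex (suc i))
    steps zero _ = subst (E x) (sym (start w)) e
    steps (suc i) (s≤s i<m) = step w i i<m

  walk0 : ∀ {x y} → Walk x y 0 → x ≡ y
  walk0 w = trans (sym (start w)) (end w)

  tailW : ∀ {x y m} (w : Walk x y (suc m)) → Walk (at w 1) y m
  tailW w = mkWalk (λ k → at w (suc k)) refl (end w) (λ i i<m → step w (suc i) (s≤s i<m))

  headE : ∀ {x y m} (w : Walk x y (suc m)) → E x (at w 1)
  headE w = subst (λ v → E v (at w 1)) (start w) (step w 0 (s≤s z≤n))

  appW : ∀ {x y z} a {b} → Walk x y a → Walk y z b → Walk x z (a + b)
  appW zero w₁ w₂ = subst (λ v → Walk v _ _) (sym (walk0 w₁)) w₂
  appW (suc a) w₁ w₂ = consW (headE w₁) (appW a (tailW w₁) w₂)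

  at-subst : ∀ {x x′ y m} (eq : x ≡ x′) (w : Walk x y m) k → at (subst (λ v → Walk v y m) eq w) k ≡ at w k
  at-subst refl w k = refl

  appW-l : ∀ {x y z} a {b} (w₁ : Walk x y a) (w₂ : Walk y z b) k → k ≤ a → at (appW a w₁ w₂) k ≡ at w₁ k
  appW-l zero w₁ w₂ zero _ = trans (at-subst (sym (walk0 w₁)) w₂ 0) (trans (start w₂) (sym (end w₁)))
  appW-l (suc a) w₁ w₂ zero _ = sym (start w₁)
  appW-l (suc a) w₁ w₂ (suc k) (s≤s k≤a) = appW-l a (tailW w₁) w₂ k k≤a

  appW-r : ∀ {x y z} a {b} (w₁ : Walk x y a) (w₂ : Walk y z b) k → at (appW a w₁ w₂) (a + k) ≡ at w₂ k
  appW-r zero w₁ w₂ k = at-subst (sym (walk0 w₁)) w₂ k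
  appW-r (suc a) w₁ w₂ k = appW-r a (tailW w₁) w₂ k

  subW : ∀ {x y m} (w : Walk x y m) i j → i ≤ j → j ≤ m → Walk (at w i) (at w j) (j ∸ i)
  subW {m = m} w i j i≤j j≤m = mkWalk (λ k → at w (i + k)) (cong (at w) (+-identityʳ i))
    (cong (at w) (m+[n∸m]≡n i≤j))
    (λ k k<j∸i → subst (λ v → E (at w (i + k)) (at w v)) (sym (+-suc i k))
       (step w (i + k) (inside k k<j∸i)))
    where
    inside : ∀ k → k < j ∸ i → i + k < m
    inside k k<j∸i = ≤-trans (subst (λ v → v ≤ j) (+-suc i k)
                       (subst (λ v → i + suc k ≤ v) (m+[n∸m]≡n i≤j) (+-monoʳ-≤ i k<j∸i))) j≤m

  revW : ∀ {x y m} → Walk x y m → Walk y x m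
  revW {x} {y} {m} w = mkWalk (λ k → at w (m ∸ k)) (end w) (trans (cong (at w) (n∸n≡0 m)) (start w)) steps
    where
    steps : ∀ i → i < m → E (at w (m ∸ i)) (at w (m ∸ suc i))
    steps i i<m = E-sym (subst (λ v → E (at w (m ∸ suc i)) (at w v)) eq
                   (step w (m ∸ suc i) (subst (_≤ m) (sym eq) (m∸n≤m m i))))
      where
      eq : suc (m ∸ suc i) ≡ m ∸ i
      eq = sym (+-∸-assoc 1 i<m)

  relength : ∀ {x y m m′} → m ≡ m′ → Walk x y m → Walk x y m′
  relength {x} {y} eq w = mkWalk (at w) (start w) (subst (λ l → at w l ≡ y) eq (end w))
    (λ i i<m′ → step w i (subst (i <_) (sym eq) i<m′))

  toWalk : ∀ {x y m} → Walk x y m → HasWalkOfLength T x y m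
  toWalk {x} {y} {m} w = (λ i → at w (toℕ i)) , start w , trans (cong (at w) (FP.toℕ-fromℕ m)) (end w) ,
    λ i → subst (λ v → E (at w v) (at w (suc (toℕ i)))) (sym (FP.toℕ-inject₁ i)) (step w (toℕ i) (FP.toℕ<n i))

  fromWalk : ∀ {x y m} → HasWalkOfLength T x y m → Walk x y m
  fromWalk {x} {y} {m} (p , p0 , pm , steps) = mkWalk (λ k → p (clamp m k)) p0
    (trans (cong p (FP.toℕ-injective (trans (clamp-toℕ m m ≤-refl) (sym (FP.toℕ-fromℕ m))))) pm)
    steps′
    where
    steps′ : ∀ i → i < m → E (p (clamp m i)) (p (clamp m (suc i)))
    steps′ i i<m = subst₂ (λ a b → E (p a) (p b)) here next (steps (fromℕ< i<m))
      where
      here : inject₁ (fromℕ< i<m) ≡ clamp m i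
      here = FP.toℕ-injective (trans (FP.toℕ-inject₁ (fromℕ< i<m))
               (trans (FP.toℕ-fromℕ< i<m) (sym (clamp-toℕ m i (<⇒≤ i<m)))))
      next : suc (fromℕ< i<m) ≡ clamp m (suc i)
      next = FP.toℕ-injective (trans (cong suc (FP.toℕ-fromℕ< i<m)) (sym (clamp-toℕ m (suc i) i<m)))

  DistinctUpTo : ℕ → (ℕ → Fin n) → Set
  DistinctUpTo m v = ∀ i j → i ≤ m → j ≤ m → v i ≡ v j → i ≡ j

  toPath : ∀ {x y m} (w : Walk x y m) → DistinctUpTo m (at w) → IsPath T m (proj₁ (toWalk w)) x y
  toPath w distinct = proj₂ (toWalk w) , λ {i} {j} eq →
    FP.toℕ-injective (distinct (toℕ i) (toℕ j) (FP.toℕ≤pred[n] i) (FP.toℕ≤pred[n] j) eq)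

  Walk? : ∀ l x y → Dec (Walk x y l)
  Walk? zero x y with x F.≟ y
  ... | yes refl = yes nilW
  ... | no x≢y = no (λ w → x≢y (walk0 w))
  Walk? (suc l) x y with FP.any? (λ z → E? x z ×-dec Walk? l z y)
  ... | yes (z , e , w) = yes (consW e w)
  ... | no none = no (λ w → none (at w 1 , headE w , tailW w))

module Metric {n : ℕ} (T : Graph n) (conn : Connected T) where
  open Walks T public

  -- Kept abstract so that d never unfolds into the search computing it.
  abstract
   distance : ∀ x y → Σ ℕ (IsLeast (Walk x y))
   distance x y = least (Walk x y) (λ l → Walk? l x y) (proj₁ (conn x y)) (fromWalk (proj₂ (conn x y)))

  d : Fin n → Fin n → ℕ
  d x y = proj₁ (distance x y)

  geodesic : ∀ x y → Walk x y (d x y)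
  geodesic x y = proj₁ (proj₂ (distance x y))

  d-min : ∀ {x y l} → Walk x y l → d x y ≤ l
  d-min {x} {y} w = proj₂ (proj₂ (distance x y)) _ w

  Dist-d : ∀ x y → Dist T x y (d x y)
  Dist-d x y = toWalk (geodesic x y) , λ l hw → d-min (fromWalk hw)

  Dist⇒≡d : ∀ {x y a} → Dist T x y a → a ≡ d x y
  Dist⇒≡d {x} {y} (hw , minimal) =
    least-unique (fromWalk hw , λ l w → minimal l (toWalk w)) (proj₂ (distance x y))

  d-sym : ∀ x y → d x y ≡ d y x
  d-sym x y = ≤-antisym (d-min (revW (geodesic y x))) (d-min (revW (geodesic x y)))

  d-tri : ∀ x y z → d x z ≤ d x y + d y z
  d-tri x y z = d-min (appW (d x y) (geodesic x y) (geodesic y z))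

  d-refl : ∀ x → d x x ≡ 0
  d-refl x = n≤0⇒n≡0 (d-min (nilW {x}))

  d≡0⇒≡ : ∀ {x y} → d x y ≡ 0 → x ≡ y
  d≡0⇒≡ {x} {y} eq = walk0 (subst (Walk x y) eq (geodesic x y))

  d-pos : ∀ {x y} → x ≢ y → 0 < d x y
  d-pos {x} {y} x≢y with d x y in eq
  ... | zero = ⊥-elim (x≢y (d≡0⇒≡ eq))
  ... | suc _ = s≤s z≤n

  d-E : ∀ {x y} → E x y → d x y ≡ 1
  d-E e = ≤-antisym (d-min (consW e nilW)) (d-pos (E≢ e))

  d-E≤ : ∀ {x y} z → E x y → d x z ≤ suc (d y z)
  d-E≤ {x} {y} z e = subst (λ v → d x z ≤ v + d y z) (d-E e) (d-tri x y z)

  module Geodesic {x y : Fin n} (w : Walk x y (d x y)) where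
    on-geodesic : ∀ j → j ≤ d x y → d x (at w j) ≡ j × d (at w j) y ≡ d x y ∸ j
    on-geodesic j j≤ = squeeze from-start to-end (subst (_≤ d x (at w j) + d (at w j) y) (sym (m+[n∸m]≡n j≤)) (d-tri x (at w j) y))
      where
      from-start : d x (at w j) ≤ j
      from-start = subst (λ v → d v (at w j) ≤ j) (start w) (d-min (subW w 0 j z≤n j≤))
      to-end : d (at w j) y ≤ d x y ∸ j
      to-end = subst (λ v → d (at w j) v ≤ d x y ∸ j) (end w) (d-min (subW w j (d x y) j≤ ≤-refl))

    d-start : ∀ j → j ≤ d x y → d x (at w j) ≡ j
    d-start j j≤ = proj₁ (on-geodesic j j≤)

    d-end : ∀ j → j ≤ d x y → d (at w j) y ≡ d x y ∸ j
    d-end j j≤ = proj₂ (on-geodesic j j≤)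

    geodesic-inj : DistinctUpTo (d x y) (at w)
    geodesic-inj i j i≤ j≤ eq = trans (sym (d-start i i≤)) (trans (cong (d x) eq) (d-start j j≤))

  -- A shortest walk visits distinct vertices, so distances are below n.
  d<n : ∀ x y → d x y < n
  d<n x y = FP.injective⇒≤ {f = vertex} vertex-inj
    where
    open Geodesic (geodesic x y)
    vertex : Fin (suc (d x y)) → Fin n
    vertex i = at (geodesic x y) (toℕ i)
    vertex-inj : Injective _≡_ _≡_ vertex
    vertex-inj {i} {j} eq = FP.toℕ-injective (geodesic-inj (toℕ i) (toℕ j) (FP.toℕ≤pred[n] i) (FP.toℕ≤pred[n] j) eq)

  -- If z lies metrically between x and y, some shortest x–y path passes
  -- through z; as no x–y path is shorter, ς(x, y) relative to z is d x y.
  between⇒varsigma : ∀ {x y z} → d x y ≡ d x z + d z y → VarsigmaPair T x y z (d x y)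
  between⇒varsigma {x} {y} {z} eq =
    (proj₁ (toWalk Q) , toPath Q geodesic-inj , fromℕ< z-pos , z-on-Q) ,
    λ l (p , (walk , _) , _) → d-min (fromWalk (p , walk))
    where
    Q : Walk x y (d x y)
    Q = relength (sym eq) (appW (d x z) (geodesic x z) (geodesic z y))
    open Geodesic Q
    z-pos : d x z < suc (d x y)
    z-pos = s≤s (subst (d x z ≤_) (sym eq) (m≤m+n (d x z) (d z y)))
    z-on-Q : at Q (toℕ (fromℕ< z-pos)) ≡ z
    z-on-Q = trans (cong (at Q) (FP.toℕ-fromℕ< z-pos))
               (trans (appW-l (d x z) (geodesic x z) (geodesic z y) (d x z) ≤-refl) (end (geodesic x z)))

-- Distances in a tree: an edge a – b splits the tree into the side of a
-- (vertices strictly closer to a) and the side of b.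
module TreeMetric {n : ℕ} (T : Graph n) (conn : Connected T) (acyc : ¬ HasCycle T) where
  open Metric T conn public

  no-cycle : ∀ {x y m} (w : Walk x y m) → 2 ≤ m → DistinctUpTo m (at w) → E y x → ⊥
  no-cycle w 2≤m distinct e = acyc (_ , 2≤m , proj₁ (toWalk w) , _ , _ , toPath w distinct , e)

  no-triangle : ∀ {a b c} → E a b → E b c → E c a → ⊥
  no-triangle {a} {b} {c} eab ebc eca = no-cycle (consW eab (consW ebc nilW)) (s≤s (s≤s z≤n)) distinct eca
    where
    distinct : DistinctUpTo 2 (at (consW eab (consW ebc nilW)))
    distinct 0 0 _ _ _ = refl
    distinct 0 1 _ _ e = ⊥-elim (E≢ eab e)
    distinct 0 2 _ _ e = ⊥-elim (E≢ eca (sym e))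
    distinct 1 0 _ _ e = ⊥-elim (E≢ eab (sym e))
    distinct 1 1 _ _ _ = refl
    distinct 1 2 _ _ e = ⊥-elim (E≢ ebc e)
    distinct 2 0 _ _ e = ⊥-elim (E≢ eca e)
    distinct 2 1 _ _ e = ⊥-elim (E≢ ebc (sym e))
    distinct 2 2 _ _ _ = refl
    distinct (suc (suc (suc i))) j (s≤s (s≤s ())) _ _
    distinct 0 (suc (suc (suc j))) _ (s≤s (s≤s ())) _
    distinct 1 (suc (suc (suc j))) _ (s≤s (s≤s ())) _
    distinct 2 (suc (suc (suc j))) _ (s≤s (s≤s ())) _

  Side : Fin n → Fin n → Fin n → Set
  Side a b z = d z a < d z b

  Side? : ∀ a b z → Dec (Side a b z)
  Side? a b z = d z a <? d z b

  -- Walking a → a′ → b′ → b (with a′ on a's side and b′ not) and closing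
  -- with the edge b – a gives a cycle once the walk has length ≥ 2.
  crossing-cycle : ∀ {a b a′ b′} → E a b → Side a b a′ → E a′ b′ → ¬ Side a b b′ →
                   2 ≤ d a a′ + suc (d b′ b) → ⊥
  crossing-cycle {a} {b} {a′} {b′} eab a′-side e′ b′-side two = no-cycle w two distinct (E-sym eab)
    where
    p q : ℕ
    p = d a a′
    q = d b′ b
    w₁ : Walk a a′ p
    w₁ = geodesic a a′
    w₂ : Walk b′ b q
    w₂ = geodesic b′ b
    w : Walk a b (p + suc q)
    w = appW p w₁ (consW e′ w₂)
    module G₁ = Geodesic w₁
    module G₂ = Geodesic w₂
    on-w₁ : ∀ k → k ≤ p → at w k ≡ at w₁ k
    on-w₁ k k≤p = appW-l p w₁ (consW e′ w₂) k k≤p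
    on-w₂ : ∀ j → at w (p + suc j) ≡ at w₂ j
    on-w₂ j = appW-r p w₁ (consW e′ w₂) (suc j)
    -- the first segment stays on a's side …
    side₁ : ∀ k → k ≤ p → Side a b (at w₁ k)
    side₁ k k≤p = subst (_< d (at w₁ k) b) (trans (sym (G₁.d-start k k≤p)) (d-sym a (at w₁ k))) k<
      where
      far : suc p ≤ d a′ b
      far = subst (λ v → suc v ≤ d a′ b) (d-sym a′ a) (≮⇒≥ (λ h → <⇒≱ a′-side (s≤s⁻¹ h)))
      via : d a′ b ≤ (p ∸ k) + d (at w₁ k) b
      via = subst (λ v → d a′ b ≤ v + d (at w₁ k) b) (trans (d-sym a′ (at w₁ k)) (G₁.d-end k k≤p)) (d-tri a′ (at w₁ k) b)
      k< : k < d (at w₁ k) b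
      k< = +-cancelʳ-≤ (p ∸ k) (suc k) (d (at w₁ k) b)
             (subst (_≤ d (at w₁ k) b + (p ∸ k)) (cong suc (sym (m+[n∸m]≡n k≤p)))
               (subst (suc p ≤_) (+-comm (p ∸ k) (d (at w₁ k) b)) (≤-trans far via)))
    -- … and the second one never enters it
    side₂ : ∀ j → j ≤ q → ¬ Side a b (at w₂ j)
    side₂ j j≤q = ≤⇒≯ (subst (_≤ d (at w₂ j) a) (sym (G₂.d-end j j≤q)) q∸j≤)
      where
      q≤ : q ≤ j + d (at w₂ j) a
      q≤ = ≤-trans (≮⇒≥ b′-side) (subst (λ v → d b′ a ≤ v + d (at w₂ j) a) (G₂.d-start j j≤q) (d-tri b′ (at w₂ j) a))
      q∸j≤ : q ∸ j ≤ d (at w₂ j) a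
      q∸j≤ = ≤-trans (∸-monoˡ-≤ j q≤) (≤-reflexive (m+n∸m≡n j (d (at w₂ j) a)))
    apart : ∀ k j → k ≤ p → j ≤ q → at w₁ k ≢ at w₂ j
    apart k j k≤ j≤ eq = side₂ j j≤ (subst (Side a b) eq (side₁ k k≤))
    bound₂ : ∀ {j} → p + suc j ≤ p + suc q → j ≤ q
    bound₂ h = s≤s⁻¹ (+-cancelˡ-≤ p _ _ h)
    distinct : DistinctUpTo (p + suc q) (at w)
    distinct i j hi hj eq with split-≤ p i | split-≤ p j
    ... | inj₁ i≤ | inj₁ j≤ = G₁.geodesic-inj i j i≤ j≤ (trans (sym (on-w₁ i i≤)) (trans eq (on-w₁ j j≤)))
    ... | inj₁ i≤ | inj₂ (j′ , refl) = ⊥-elim (apart i j′ i≤ (bound₂ hj) (trans (sym (on-w₁ i i≤)) (trans eq (on-w₂ j′))))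
    ... | inj₂ (i′ , refl) | inj₁ j≤ = ⊥-elim (apart j i′ j≤ (bound₂ hi) (trans (sym (on-w₁ j j≤)) (trans (sym eq) (on-w₂ i′))))
    ... | inj₂ (i′ , refl) | inj₂ (j′ , refl) = cong (λ v → p + suc v)
           (G₂.geodesic-inj i′ j′ (bound₂ hi) (bound₂ hj) (trans (sym (on-w₂ i′)) (trans eq (on-w₂ j′))))

  unique-crossing : ∀ {a b a′ b′} → E a b → Side a b a′ → E a′ b′ → ¬ Side a b b′ → a′ ≡ a × b′ ≡ b
  unique-crossing {a} {b} {a′} {b′} eab a′-side e′ b′-side with zeros-or-2≤ (d a a′) (d b′ b)
  ... | inj₁ (p≡0 , q≡0) = sym (d≡0⇒≡ p≡0) , d≡0⇒≡ q≡0
  ... | inj₂ two = ⊥-elim (crossing-cycle eab a′-side e′ b′-side two)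

  -- A shortest way from the side of a to a vertex y outside it uses the
  -- edge a – b, so d z y = d z a + 1 + d b y.
  across-edge-≥ : ∀ {a b y} → E a b → ¬ Side a b y → ∀ s z → Side a b z → Walk z y s → d z a + suc (d b y) ≤ s
  across-edge-≥ {a} {b} {y} eab y-out zero z z-in w = ⊥-elim (y-out (subst (Side a b) (walk0 w) z-in))
  across-edge-≥ {a} {b} {y} eab y-out (suc s) z z-in w with Side? a b (at w 1)
  ... | yes next-in = ≤-trans (+-monoˡ-≤ (suc (d b y)) (d-E≤ a (headE w)))
                        (s≤s (across-edge-≥ eab y-out s (at w 1) next-in (tailW w)))
  ... | no next-out with unique-crossing eab z-in (headE w) next-out
  ... | refl , next≡b = subst (λ v → v + suc (d b y) ≤ suc s) (sym (d-refl z))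
                          (s≤s (d-min (subst (λ v → Walk v y s) next≡b (tailW w))))

  across-edge : ∀ {a b y z} → E a b → ¬ Side a b y → Side a b z → d z y ≡ d z a + suc (d b y)
  across-edge {a} {b} {y} {z} eab y-out z-in = ≤-antisym
    (≤-trans (d-tri z a y) (+-monoʳ-≤ (d z a) (d-E≤ y eab)))
    (across-edge-≥ eab y-out (d z y) z z-in (geodesic z y))

  self-side : ∀ {v p} → E v p → Side v p v
  self-side {v} {p} e = subst₂ _<_ (sym (d-refl v)) (sym (d-E e)) (s≤s z≤n)

  not-self-side : ∀ {v p} → E v p → ¬ Side v p p
  not-self-side {v} {p} e h = <⇒≱ h (subst (_≤ d p v) (sym (d-refl p)) z≤n)

  child-side : ∀ {v p c} → E v p → E v c → c ≢ p → Side v p c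
  child-side {v} {p} {c} evp evc c≢p = subst (_< d c p) (sym (d-E (E-sym evc))) (far (d c p) refl)
    where
    far : ∀ m → d c p ≡ m → 1 < m
    far zero eq = ⊥-elim (c≢p (d≡0⇒≡ eq))
    far (suc zero) eq = ⊥-elim (no-triangle evc (adjacent eq) (E-sym evp))
      where
      adjacent : d c p ≡ 1 → E c p
      adjacent eq₁ = subst₂ E (start w) (end w) (step w 0 (s≤s z≤n))
        where
        w : Walk c p 1
        w = subst (Walk c p) eq₁ (geodesic c p)
    far (suc (suc m)) eq = s≤s (s≤s z≤n)

  side-nested : ∀ {v p c} → E v p → Side v p c → E c v → ∀ {z} → Side c v z → Side v p z
  side-nested {v} {p} {c} evp c-in ecv {z} z-in with Side? v p z
  ... | yes h = h
  ... | no z-out = ⊥-elim (1+n≰n (≤-trans (n≤1+n _) (subst (λ x → suc x ≤ suc (d p z)) via-c (≤-trans z-in via-v))))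
    where
    via-c : d z c ≡ suc (suc (d p z))
    via-c = trans (d-sym z c) (trans (across-edge evp z-out c-in) (cong (_+ suc (d p z)) (d-E ecv)))
    via-v : d z v ≤ suc (d p z)
    via-v = subst (_≤ suc (d p z)) (d-sym v z) (d-E≤ z evp)

  sibling-sides-disjoint : ∀ {v c₁ c₂ z} → E c₁ v → E c₂ v → c₁ ≢ c₂ → Side c₁ v z → Side c₂ v z → ⊥
  sibling-sides-disjoint {v} {c₁} {c₂} {z} e₁ e₂ c₁≢c₂ z-in₁ z-in₂ =
    1+n≰n (≤-trans (n≤1+n _) (subst (λ x → suc x ≤ suc (d z c₁)) via-c₁ (≤-trans z-in₂ via-v)))
    where
    c₂-out : ¬ Side c₁ v c₂
    c₂-out h = c₁≢c₂ (sym (d≡0⇒≡ (n≤0⇒n≡0 (s≤s⁻¹ (subst (d c₂ c₁ <_) (d-E e₂) h)))))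
    via-c₁ : d z c₂ ≡ suc (suc (d z c₁))
    via-c₁ = trans (across-edge e₁ c₂-out z-in₁)
               (trans (cong (λ k → d z c₁ + suc k) (d-E (E-sym e₂))) (+-comm (d z c₁) 2))
    via-v : d z v ≤ suc (d z c₁)
    via-v = subst₂ _≤_ (d-sym v z) (cong suc (d-sym c₁ z)) (d-E≤ z (E-sym e₁))

-- A leg of a vertex e is a pendant path e – ℓ 0 – ℓ 1 – … – ℓ (t - 1) whose
-- vertices have no neighbours besides their predecessor and successor, so
-- that ℓ (t - 1) is a leaf.
module Legs {n : ℕ} (T : Graph n) (conn : Connected T) (acyc : ¬ HasCycle T) where
  open TreeMetric T conn acyc public

  degree≤2 : ∀ {v x y} → ¬ IsMajor T v → E v x → E v y → x ≢ y → ∀ z → E v z → z ≡ x ⊎ z ≡ y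
  degree≤2 {v} {x} {y} not-major ex ey x≢y z ez with z F.≟ x | z F.≟ y
  ... | yes z≡x | _ = inj₁ z≡x
  ... | no _ | yes z≡y = inj₂ z≡y
  ... | no z≢x | no z≢y = ⊥-elim (not-major (x , y , z , ex , ey , ez , x≢y , (λ e → z≢x (sym e)) , (λ e → z≢y (sym e))))

  prev : Fin n → (ℕ → Fin n) → ℕ → Fin n
  prev e ℓ zero = e
  prev e ℓ (suc i) = ℓ i

  record Leg (e : Fin n) (t : ℕ) : Set where
    constructor mkLeg
    field
      ℓ : ℕ → Fin n
      to-prev : ∀ i → i < t → E (ℓ i) (prev e ℓ i)
      neighbours : ∀ i → i < t → ∀ z → E (ℓ i) z → z ≡ prev e ℓ i ⊎ (suc i < t × z ≡ ℓ (suc i))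
      avoids-base : ∀ i → i < t → ℓ i ≢ e

  module LegFacts {e : Fin n} {t : ℕ} (L : Leg e t) where
    open Leg L

    OffLeg : Fin n → Set
    OffLeg z = ∀ i → i < t → ℓ i ≢ z

    on-leg? : ∀ z → (Σ ℕ λ i → i < t × ℓ i ≡ z) ⊎ OffLeg z
    on-leg? z with FP.any? {n = t} (λ i → ℓ (toℕ i) F.≟ z)
    ... | yes (i , eq) = inj₁ (toℕ i , FP.toℕ<n i , eq)
    ... | no none = inj₂ (λ i i<t eq → none (fromℕ< i<t , trans (cong ℓ (FP.toℕ-fromℕ< i<t)) eq))

    walk-to-base : ∀ i → i < t → Walk (ℓ i) e (suc i)
    walk-to-base zero h = consW (to-prev 0 h) nilW
    walk-to-base (suc i) h = consW (to-prev (suc i) h) (walk-to-base i (<⇒≤ h))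

    -- Any walk from ℓ i off the leg must first climb back to e.
    leaving-walk : ∀ s i z → i < t → OffLeg z → Walk (ℓ i) z s → suc i + d e z ≤ s
    leaving-walk zero i z i<t off w = ⊥-elim (off i i<t (walk0 w))
    leaving-walk (suc s) i z i<t off w with neighbours i i<t (at w 1) (headE w)
    leaving-walk (suc s) zero z i<t off w | inj₁ up =
      s≤s (d-min (subst (λ v → Walk v z s) up (tailW w)))
    leaving-walk (suc s) (suc i) z i<t off w | inj₁ up =
      s≤s (leaving-walk s i z (<⇒≤ i<t) off (subst (λ v → Walk v z s) up (tailW w)))
    ... | inj₂ (si<t , down) = s≤s (≤-trans (≤-trans (n≤1+n _) (n≤1+n _))
                                 (leaving-walk s (suc i) z si<t off (subst (λ v → Walk v z s) down (tailW w))))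

    d-off-leg : ∀ i z → i < t → OffLeg z → d (ℓ i) z ≡ suc i + d e z
    d-off-leg i z i<t off = ≤-antisym (≤-trans (d-tri (ℓ i) e z) (+-monoˡ-≤ (d e z) (d-min (walk-to-base i i<t))))
                              (leaving-walk (d (ℓ i) z) i z i<t off (geodesic (ℓ i) z))

    d-to-base : ∀ i → i < t → d (ℓ i) e ≡ suc i
    d-to-base i i<t = trans (d-off-leg i e i<t avoids-base) (trans (cong (suc i +_) (d-refl e)) (+-identityʳ (suc i)))

    d-prev-to-base : ∀ i → i ≤ t → d (prev e ℓ i) e ≡ i
    d-prev-to-base zero _ = d-refl e
    d-prev-to-base (suc i) h = d-to-base i h

    leg-inj : ∀ i j → i < t → j < t → ℓ i ≡ ℓ j → i ≡ j
    leg-inj i j hi hj eq = suc-injective (trans (sym (d-to-base i hi)) (trans (cong (λ v → d v e) eq) (d-to-base j hj)))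

    not-major : ∀ i → i < t → ¬ IsMajor T (ℓ i)
    not-major i i<t (a , b , c , ea , eb , ec , a≢b , a≢c , b≢c) =
      pigeon3 (prev-or-next a ea) (prev-or-next b eb) (prev-or-next c ec) a≢b a≢c b≢c
      where
      prev-or-next : ∀ z → E (ℓ i) z → z ≡ prev e ℓ i ⊎ z ≡ ℓ (suc i)
      prev-or-next z ez with neighbours i i<t z ez
      ... | inj₁ p = inj₁ p
      ... | inj₂ (_ , p) = inj₂ p

    major-off-leg : ∀ w → IsMajor T w → OffLeg w
    major-off-leg w w-major i i<t eq = not-major i i<t (subst (IsMajor T) (sym eq) w-major)

  module LegEnd {e : Fin n} {t : ℕ} (L : Leg e (suc t)) where
    open Leg L
    open LegFacts L

    end-degree-one : HasDegreeOne T (ℓ t)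
    end-degree-one = prev e ℓ t , to-prev t ≤-refl , only
      where
      only : ∀ z′ → E (ℓ t) z′ → z′ ≡ prev e ℓ t
      only z′ ez with neighbours t ≤-refl z′ ez
      ... | inj₁ p = p
      ... | inj₂ (h , _) = ⊥-elim (<-irrefl refl h)

    end-terminal : IsMajor T e → IsTerminal T (ℓ t) e
    end-terminal e-major = e-major , end-degree-one , λ w w-major w≢e a b da db →
      subst₂ _<_ (sym (trans (Dist⇒≡d da) (d-to-base t ≤-refl)))
        (sym (trans (Dist⇒≡d db) (d-off-leg t w ≤-refl (major-off-leg w w-major))))
        (m<m+n (suc t) (d-pos (λ eq → w≢e (sym eq))))

  -- Walking down both legs
  -- simultaneously, a common vertex at depth i forces a common vertex at
  -- depth i + 1 (the only other neighbour lies at depth i - 1), until the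
  -- end of the shorter leg, where the legs would have to end together.
  module DisjointLegs {e : Fin n} {s₁ s₂ : ℕ} (L₁ : Leg e (suc s₁)) (L₂ : Leg e (suc s₂))
                      (ends-differ : Leg.ℓ L₁ s₁ ≢ Leg.ℓ L₂ s₂) where
    ℓ₁ ℓ₂ : ℕ → Fin n
    ℓ₁ = Leg.ℓ L₁
    ℓ₂ = Leg.ℓ L₂

    not-shared-at-end : s₁ < suc s₂ → ℓ₁ s₁ ≢ ℓ₂ s₁
    not-shared-at-end s₁<t₂ shared with suc s₁ <? suc s₂
    ... | no last₂ = ends-differ (subst (λ b → ℓ₁ s₁ ≡ ℓ₂ b) (≤-antisym (s≤s⁻¹ s₁<t₂) (s≤s⁻¹ (≮⇒≥ last₂))) shared)
    ... | yes ss₁<t₂ with Leg.neighbours L₁ s₁ ≤-refl (ℓ₂ (suc s₁))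
                           (subst (λ v → E v (ℓ₂ (suc s₁))) (sym shared) (E-sym (Leg.to-prev L₂ (suc s₁) ss₁<t₂)))
    ... | inj₁ up = 2+n≢n (trans (sym (LegFacts.d-to-base L₂ (suc s₁) ss₁<t₂))
                      (trans (cong (λ v → d v e) up) (LegFacts.d-prev-to-base L₁ s₁ (n≤1+n s₁))))
    ... | inj₂ (s₁<s₁ , _) = <-irrefl refl s₁<s₁

    next-on-L₁ : ∀ {i k} → i + suc k ≡ s₁ → suc i < suc s₁
    next-on-L₁ {i} {k} eq = s≤s (subst (suc i ≤_) eq (≤-trans (s≤s (m≤m+n i k)) (≤-reflexive (sym (+-suc i k)))))

    not-shared : ∀ k i → i + k ≡ s₁ → i < suc s₂ → ℓ₁ i ≢ ℓ₂ i
    not-shared zero i i+0≡s₁ with trans (sym (+-identityʳ i)) i+0≡s₁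
    ... | refl = not-shared-at-end
    not-shared (suc k) i i+sk≡s₁ i<t₂ shared with Leg.neighbours L₂ i i<t₂ (ℓ₁ (suc i))
                       (subst (λ v → E v (ℓ₁ (suc i))) shared (E-sym (Leg.to-prev L₁ (suc i) (next-on-L₁ i+sk≡s₁))))
    ... | inj₁ up = 2+n≢n (trans (sym (LegFacts.d-to-base L₁ (suc i) (next-on-L₁ i+sk≡s₁)))
                      (trans (cong (λ v → d v e) up) (LegFacts.d-prev-to-base L₂ i (<⇒≤ i<t₂))))
    ... | inj₂ (si<t₂ , next) = not-shared k (suc i) (trans (sym (+-suc i k)) i+sk≡s₁) si<t₂ next

    disjoint : ∀ i j → i < suc s₁ → j < suc s₂ → ℓ₁ i ≢ ℓ₂ j
    disjoint i j hi hj eq = not-shared (s₁ ∸ i) i (m+[n∸m]≡n (s≤s⁻¹ hi))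
      (subst (_< suc s₂) (sym i≡j) hj) (trans eq (cong ℓ₂ (sym i≡j)))
      where
      i≡j : i ≡ j
      i≡j = suc-injective (trans (sym (LegFacts.d-to-base L₁ i hi))
              (trans (cong (λ v → d v e) eq) (LegFacts.d-to-base L₂ j hj)))

  -- A terminal vertex differs from its major vertex (a major vertex has
  -- at least three neighbours, a terminal vertex only one).
  terminal≢ : ∀ {u w} → IsTerminal T u w → u ≢ w
  terminal≢ ((a , b , c , ea , eb , ec , a≢b , a≢c , b≢c) , (z , ez , only) , _) refl =
    a≢b (trans (only a ea) (sym (only b eb)))

  -- The shortest walk from a major vertex w to one of its terminal vertices
  -- u is a leg of w: its inner vertices are not major (they would be closer
  -- to u than w is), hence have degree two, and u is a leaf.
  module TerminalLeg {u w : Fin n} (u-term : IsTerminal T u w) (t : ℕ) (d≡ : d w u ≡ suc t) where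
    γ : Walk w u (d w u)
    γ = geodesic w u
    open Geodesic γ

    ℓ : ℕ → Fin n
    ℓ i = at γ (suc i)

    prev≡ : ∀ i → prev w ℓ i ≡ at γ i
    prev≡ zero = sym (start γ)
    prev≡ (suc i) = refl

    on-γ : ∀ {i} → i ≤ suc t → i ≤ d w u
    on-γ {i} h = subst (i ≤_) (sym d≡) h

    ends-at-u : ℓ t ≡ u
    ends-at-u = trans (cong (at γ) (sym d≡)) (end γ)

    to-prev : ∀ i → i < suc t → E (ℓ i) (prev w ℓ i)
    to-prev i h = subst (E (ℓ i)) (sym (prev≡ i)) (E-sym (step γ i (on-γ h)))

    avoids-base : ∀ i → i < suc t → ℓ i ≢ w
    avoids-base i h eq = 0≢1+n (trans (sym (d-refl w)) (trans (cong (d w) (sym eq)) (d-start (suc i) (on-γ h))))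

    inner-not-major : ∀ i → i < t → ¬ IsMajor T (ℓ i)
    inner-not-major i i<t i-major = ≤⇒≯ closer (proj₂ (proj₂ u-term) (ℓ i) i-major (avoids-base i (≤-trans i<t (n≤1+n t)))
                                          (d u w) (d u (ℓ i)) (Dist-d u w) (Dist-d u (ℓ i)))
      where
      closer : d u (ℓ i) ≤ d u w
      closer = subst₂ _≤_
        (sym (trans (d-sym u (ℓ i)) (trans (d-end (suc i) (on-γ (≤-trans i<t (n≤1+n t)))) (cong (_∸ suc i) d≡))))
        (sym (trans (d-sym u w) d≡)) (≤-trans (m∸n≤m t i) (n≤1+n t))

    neighbours : ∀ i → i < suc t → ∀ z → E (ℓ i) z → z ≡ prev w ℓ i ⊎ (suc i < suc t × z ≡ ℓ (suc i))
    neighbours i h z ez with suc i <? suc t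
    ... | yes si<t with degree≤2 (inner-not-major i (s≤s⁻¹ si<t)) (E-sym (step γ i (on-γ h))) (step γ (suc i) (on-γ si<t))
                          (λ eq → 2+n≢n (sym (geodesic-inj i (suc (suc i)) (on-γ (<⇒≤ h)) (on-γ si<t) eq))) z ez
    ... | inj₁ p = inj₁ (trans p (sym (prev≡ i)))
    ... | inj₂ p = inj₂ (si<t , p)
    neighbours i h z ez | no i-last = inj₁ (trans (only z eu) (trans (sym (only (at γ i) eγ)) (sym (prev≡ i))))
      where
      ℓi≡u : ℓ i ≡ u
      ℓi≡u = trans (cong ℓ (≤-antisym (s≤s⁻¹ h) (s≤s⁻¹ (≮⇒≥ i-last)))) ends-at-u
      only : ∀ z′ → E u z′ → z′ ≡ proj₁ (proj₁ (proj₂ u-term))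
      only = proj₂ (proj₂ (proj₁ (proj₂ u-term)))
      eu : E u z
      eu = subst (λ v → E v z) ℓi≡u ez
      eγ : E u (at γ i)
      eγ = subst (λ v → E v (at γ i)) ℓi≡u (E-sym (step γ i (on-γ h)))

    leg : Leg w (suc t)
    leg = mkLeg ℓ to-prev neighbours avoids-base

  terminal⇒leg : ∀ {u w} → IsTerminal T u w → Σ ℕ λ t → Σ (Leg w (suc t)) λ L → Leg.ℓ L t ≡ u
  terminal⇒leg {u} {w} u-term with d w u in d≡ | d-pos {w} {u} (λ eq → terminal≢ u-term (sym eq))
  ... | suc t | _ = t , TerminalLeg.leg u-term t d≡ , TerminalLeg.ends-at-u u-term t d≡

-- Two legs of the same vertex e with distinct ends, and the enumeration
-- ℓ₁ 0, …, ℓ₁ s₁, ℓ₂ 0, …, ℓ₂ s₂ of their vertices.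
module TwoLegs {n : ℕ} (T : Graph n) (conn : Connected T) (acyc : ¬ HasCycle T) where
  open Legs T conn acyc public

  module Enumeration {e : Fin n} {s₁ s₂ : ℕ} (L₁ : Leg e (suc s₁)) (L₂ : Leg e (suc s₂))
                     (ends-differ : Leg.ℓ L₁ s₁ ≢ Leg.ℓ L₂ s₂) where
    open DisjointLegs L₁ L₂ ends-differ public

    size : ℕ
    size = suc s₁ + suc s₂

    vertex : ℕ → Fin n
    vertex = splice (suc s₁) ℓ₁ ℓ₂

    on-L₁ : ∀ i → i < suc s₁ → vertex i ≡ ℓ₁ i
    on-L₁ = splice-l (suc s₁) ℓ₁ ℓ₂

    on-L₂ : ∀ j → vertex (suc s₁ + j) ≡ ℓ₂ j
    on-L₂ = splice-r (suc s₁) ℓ₁ ℓ₂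

    vertex-inj : ∀ i j → i < size → j < size → vertex i ≡ vertex j → i ≡ j
    vertex-inj i j hi hj eq with split-< (suc s₁) i | split-< (suc s₁) j
    ... | inj₁ i< | inj₁ j< = LegFacts.leg-inj L₁ i j i< j< (trans (sym (on-L₁ i i<)) (trans eq (on-L₁ j j<)))
    ... | inj₁ i< | inj₂ (j′ , refl) = ⊥-elim (disjoint i j′ i< (+-cancelˡ-< (suc s₁) _ _ hj)
          (trans (sym (on-L₁ i i<)) (trans eq (on-L₂ j′))))
    ... | inj₂ (i′ , refl) | inj₁ j< = ⊥-elim (disjoint j i′ j< (+-cancelˡ-< (suc s₁) _ _ hi)
          (trans (sym (on-L₁ j j<)) (trans (sym eq) (on-L₂ i′))))
    ... | inj₂ (i′ , refl) | inj₂ (j′ , refl) = cong (suc s₁ +_)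
          (LegFacts.leg-inj L₂ i′ j′ (+-cancelˡ-< (suc s₁) _ _ hi) (+-cancelˡ-< (suc s₁) _ _ hj)
            (trans (sym (on-L₂ i′)) (trans eq (on-L₂ j′))))

    vertex-on-legs : ∀ i → i < size →
                     (Σ ℕ λ j → j < suc s₁ × vertex i ≡ ℓ₁ j) ⊎ (Σ ℕ λ j → j < suc s₂ × vertex i ≡ ℓ₂ j)
    vertex-on-legs i hi with split-< (suc s₁) i
    ... | inj₁ i< = inj₁ (i , i< , on-L₁ i i<)
    ... | inj₂ (i′ , refl) = inj₂ (i′ , +-cancelˡ-< (suc s₁) _ _ hi , on-L₂ i′)

    enumerated-or-off : ∀ z → (Σ ℕ λ j → j < size × vertex j ≡ z) ⊎ (LegFacts.OffLeg L₁ z × LegFacts.OffLeg L₂ z)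
    enumerated-or-off z with LegFacts.on-leg? L₁ z
    ... | inj₁ (j , j< , eq) = inj₁ (j , ≤-trans j< (m≤m+n _ _) , trans (on-L₁ j j<) eq)
    ... | inj₂ off₁ with LegFacts.on-leg? L₂ z
    ... | inj₁ (j , j< , eq) = inj₁ (suc s₁ + j , +-monoʳ-< (suc s₁) j< , trans (on-L₂ j) eq)
    ... | inj₂ off₂ = inj₂ (off₁ , off₂)

    -- If s₁ ≤ s₂, the vertices ℓ₁ s₁ and ℓ₂ s₁ (same depth on both legs) are
    -- distinguished only by vertices of the legs, so no k-metric generator
    -- has k > size.
    generator-bound : s₁ ≤ s₂ → ∀ k S → IsKMetricGenerator T k S → k ≤ size
    generator-bound s₁≤s₂ k S gen with gen (ℓ₁ s₁) (ℓ₂ s₁) (disjoint s₁ s₁ ≤-refl (s≤s s₁≤s₂))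
    ... | f , f-inj , f-dist = injective-decoded⇒≤ size vertex f f-inj enumerated
      where
      enumerated : ∀ i → Σ ℕ λ j → j < size × vertex j ≡ f i
      enumerated i with enumerated-or-off (f i)
      ... | inj₁ found = found
      ... | inj₂ (off₁ , off₂) with proj₂ (f-dist i)
      ... | a , b , da , db , a≢b = ⊥-elim (a≢b (trans (Dist⇒≡d da) (trans (LegFacts.d-off-leg L₁ s₁ (f i) ≤-refl off₁)
              (sym (trans (Dist⇒≡d db) (LegFacts.d-off-leg L₂ s₁ (f i) (s≤s s₁≤s₂) off₂))))))

-- A fork is a major vertex with two legs whose ends differ; its ends are
-- terminal vertices of the centre and its span is their distance.
module Forks {n : ℕ} (T : Graph n) (conn : Connected T) (acyc : ¬ HasCycle T) where
  open TwoLegs T conn acyc public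

  record Fork : Set where
    constructor mkFork
    field
      centre : Fin n
      centre-major : IsMajor T centre
      s₁ s₂ : ℕ
      L₁ : Leg centre (suc s₁)
      L₂ : Leg centre (suc s₂)
      ends-differ : Leg.ℓ L₁ s₁ ≢ Leg.ℓ L₂ s₂

  module ForkFacts (F : Fork) where
    open Fork F
    open Enumeration L₁ L₂ ends-differ public

    u₁ u₂ : Fin n
    u₁ = ℓ₁ s₁
    u₂ = ℓ₂ s₂

    span : ℕ
    span = size

    span-bound : ∀ k S → IsKMetricGenerator T k S → k ≤ span
    span-bound k S gen with ≤-total s₁ s₂
    ... | inj₁ s₁≤s₂ = generator-bound s₁≤s₂ k S gen
    ... | inj₂ s₂≤s₁ = subst (k ≤_) (+-comm (suc s₂) (suc s₁))
                         (Enumeration.generator-bound L₂ L₁ (λ eq → ends-differ (sym eq)) s₂≤s₁ k S gen)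

    u₁-terminal : IsTerminal T u₁ centre
    u₁-terminal = LegEnd.end-terminal L₁ centre-major

    u₂-terminal : IsTerminal T u₂ centre
    u₂-terminal = LegEnd.end-terminal L₂ centre-major

    d-u₁ : d u₁ centre ≡ suc s₁
    d-u₁ = LegFacts.d-to-base L₁ s₁ ≤-refl

    d-u₂ : d centre u₂ ≡ suc s₂
    d-u₂ = trans (d-sym centre u₂) (LegFacts.d-to-base L₂ s₂ ≤-refl)

    span≡ : span ≡ d u₁ centre + d centre u₂
    span≡ = sym (cong₂ _+_ d-u₁ d-u₂)

    d-ends : d u₁ u₂ ≡ d u₁ centre + d centre u₂
    d-ends = trans (LegFacts.d-off-leg L₁ s₁ u₂ ≤-refl (λ i h eq → disjoint i s₂ h ≤-refl eq))
                   (cong (_+ d centre u₂) (sym d-u₁))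

module Descent {n : ℕ} (T : Graph n) (conn : Connected T) (acyc : ¬ HasCycle T) where
  open Forks T conn acyc public

  ForkWithin : (Fin n → Set) → Fork → Set
  ForkWithin S F = (∀ i → i < suc (Fork.s₁ F) → S (Leg.ℓ (Fork.L₁ F) i)) ×
                   (∀ i → i < suc (Fork.s₂ F) → S (Leg.ℓ (Fork.L₂ F) i))

  LegWithin : ∀ {p t} → (Fin n → Set) → Leg p t → Set
  LegWithin {t = t} S L = ∀ i → i < t → S (Leg.ℓ L i)


  data SideShape (v p : Fin n) : Set where
    has-fork : (F : Fork) → ForkWithin (Side v p) F → SideShape v p
    is-leg : ∀ t (L : Leg p (suc t)) → Leg.ℓ L 0 ≡ v → LegWithin (Side v p) L → SideShape v p

  extend-leg : ∀ {v p c t} → E v p → (L : Leg v (suc t)) → Leg.ℓ L 0 ≡ c →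
               (∀ z → E v z → z ≡ p ⊎ z ≡ c) → (∀ i → i < suc t → Leg.ℓ L i ≢ p) → Leg p (suc (suc t))
  extend-leg {v} {p} {c} {t} evp L starts-at-c v-nbrs avoids-p = mkLeg ℓ′ to-prev′ neighbours′ avoids-base′
    where
    ℓ ℓ′ : ℕ → Fin n
    ℓ = Leg.ℓ L
    ℓ′ = prev v ℓ
    prev-shift : ∀ i → prev v ℓ i ≡ prev p ℓ′ (suc i)
    prev-shift zero = refl
    prev-shift (suc i) = refl
    to-prev′ : ∀ i → i < suc (suc t) → E (ℓ′ i) (prev p ℓ′ i)
    to-prev′ zero _ = evp
    to-prev′ (suc i) h = subst (E (ℓ i)) (prev-shift i) (Leg.to-prev L i (s≤s⁻¹ h))
    neighbours′ : ∀ i → i < suc (suc t) → ∀ z → E (ℓ′ i) z → z ≡ prev p ℓ′ i ⊎ (suc i < suc (suc t) × z ≡ ℓ′ (suc i))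
    neighbours′ zero _ z ez with v-nbrs z ez
    ... | inj₁ q = inj₁ q
    ... | inj₂ q = inj₂ (s≤s (s≤s z≤n) , trans q (sym starts-at-c))
    neighbours′ (suc i) h z ez with Leg.neighbours L i (s≤s⁻¹ h) z ez
    ... | inj₁ q = inj₁ (trans q (prev-shift i))
    ... | inj₂ (h′ , q) = inj₂ (s≤s h′ , q)
    avoids-base′ : ∀ i → i < suc (suc t) → ℓ′ i ≢ p
    avoids-base′ zero _ = E≢ evp
    avoids-base′ (suc i) h = avoids-p i (s≤s⁻¹ h)

  inside-child : ∀ {v p c} → E v p → E v c → c ≢ p → ∀ {z} → Side c v z → Side v p z
  inside-child evp evc c≢p = side-nested evp (child-side evp evc c≢p) (E-sym evc)

  fork-in-child : ∀ {v p c} → E v p → E v c → c ≢ p → ∀ F → ForkWithin (Side c v) F → ForkWithin (Side v p) F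
  fork-in-child evp evc c≢p F (in₁ , in₂) =
    (λ i h → inside-child evp evc c≢p (in₁ i h)) , (λ i h → inside-child evp evc c≢p (in₂ i h))

  leaf-side : ∀ {v p} → E v p → (∀ z → E v z → z ≡ p) → SideShape v p
  leaf-side {v} {p} evp only-p = is-leg 0 (mkLeg (λ _ → v) to-prev neighbours avoids-base) refl within
    where
    to-prev : ∀ i → i < 1 → E v (prev p (λ _ → v) i)
    to-prev zero _ = evp
    to-prev (suc i) (s≤s ())
    neighbours : ∀ i → i < 1 → ∀ z → E v z → z ≡ prev p (λ _ → v) i ⊎ (suc i < 1 × z ≡ v)
    neighbours zero _ z ez = inj₁ (only-p z ez)
    neighbours (suc i) (s≤s ())
    avoids-base : ∀ i → i < 1 → v ≢ p
    avoids-base zero _ = E≢ evp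
    avoids-base (suc i) (s≤s ())
    within : LegWithin (Side v p) (mkLeg (λ _ → v) to-prev neighbours avoids-base)
    within zero _ = self-side evp
    within (suc i) (s≤s ())

  -- v has exactly one neighbour c besides p: the side of v is that of c
  -- together with v, so a fork persists and a leg grows by v.
  one-child-side : ∀ {v p c} → E v p → E v c → c ≢ p → (∀ z → E v z → z ≡ p ⊎ z ≡ c) →
                   SideShape c v → SideShape v p
  one-child-side evp evc c≢p v-nbrs (has-fork F within) =
    has-fork F (fork-in-child evp evc c≢p F within)
  one-child-side {v} {p} {c} evp evc c≢p v-nbrs (is-leg t L starts-at-c within) =
    is-leg (suc t) (extend-leg evp L starts-at-c v-nbrs avoids-p) refl within′
    where
    inside : ∀ {z} → Side c v z → Side v p z
    inside = inside-child evp evc c≢p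
    avoids-p : ∀ i → i < suc t → Leg.ℓ L i ≢ p
    avoids-p i h eq = not-self-side evp (subst (Side v p) eq (inside (within i h)))
    within′ : ∀ i → i < suc (suc t) → Side v p (prev v (Leg.ℓ L) i)
    within′ zero _ = self-side evp
    within′ (suc i) h = inside (within i (s≤s⁻¹ h))

  -- v has two neighbours c₁ ≠ c₂ besides p, so v is major: a fork in
  -- either child's side is a fork in v's side, and two legs form a fork
  -- centred at v.
  two-children-side : ∀ {v p c₁ c₂} → E v p → E v c₁ → E v c₂ → c₁ ≢ p → c₂ ≢ p → c₂ ≢ c₁ →
                      SideShape c₁ v → SideShape c₂ v → SideShape v p
  two-children-side evp e₁ e₂ c₁≢p c₂≢p c₂≢c₁ (has-fork F within) _ =
    has-fork F (fork-in-child evp e₁ c₁≢p F within)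
  two-children-side evp e₁ e₂ c₁≢p c₂≢p c₂≢c₁ (is-leg _ _ _ _) (has-fork F within) =
    has-fork F (fork-in-child evp e₂ c₂≢p F within)
  two-children-side {v} {p} {c₁} {c₂} evp e₁ e₂ c₁≢p c₂≢p c₂≢c₁ (is-leg t₁ L₁ _ within₁) (is-leg t₂ L₂ _ within₂) =
    has-fork (mkFork v v-major t₁ t₂ L₁ L₂ ends-differ)
             ((λ i h → inside-child evp e₁ c₁≢p (within₁ i h)) , (λ i h → inside-child evp e₂ c₂≢p (within₂ i h)))
    where
    v-major : IsMajor T v
    v-major = p , c₁ , c₂ , evp , e₁ , e₂ , (λ q → c₁≢p (sym q)) , (λ q → c₂≢p (sym q)) , (λ q → c₂≢c₁ (sym q))
    ends-differ : Leg.ℓ L₁ t₁ ≢ Leg.ℓ L₂ t₂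
    ends-differ eq = sibling-sides-disjoint (E-sym e₁) (E-sym e₂) (λ q → c₂≢c₁ (sym q))
                       (within₁ t₁ ≤-refl) (subst (Side c₂ v) (sym eq) (within₂ t₂ ≤-refl))

  -- Descend from the edge v – p away from a vertex r outside the side of v.
  -- Every step moves one further from r, and distances are below n, so
  -- fuel f with n ≤ d v r + f suffices.
  module DescendFrom (r : Fin n) where
    d-child : ∀ {v p c} → E v p → ¬ Side v p r → Side v p c → E c v → d c r ≡ suc (d v r)
    d-child {v} {p} {c} evp r-out c-in ecv =
      trans (across-edge evp r-out c-in) (trans (cong (_+ suc (d p r)) (d-E ecv)) (cong suc (sym d-v)))
      where
      d-v : d v r ≡ suc (d p r)
      d-v = trans (across-edge evp r-out (self-side evp)) (cong (_+ suc (d p r)) (d-refl v))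

    descend : ∀ f v p → E v p → ¬ Side v p r → n ≤ d v r + f → SideShape v p
    descend-child : ∀ f {v p} → E v p → ¬ Side v p r → n ≤ d v r + suc f → ∀ c → E v c → c ≢ p → SideShape c v

    descend zero v p evp r-out fuel = ⊥-elim (<⇒≱ (d<n v r) (subst (n ≤_) (+-identityʳ _) fuel))
    descend (suc f) v p evp r-out fuel with FP.any? (λ c → E? v c ×-dec ¬? (c F.≟ p))
    ... | no no-child = leaf-side evp only-p
      where
      only-p : ∀ z → E v z → z ≡ p
      only-p z ez with z F.≟ p
      ... | yes z≡p = z≡p
      ... | no z≢p = ⊥-elim (no-child (z , ez , z≢p))
    ... | yes (c₁ , e₁ , c₁≢p) with FP.any? (λ c → E? v c ×-dec (¬? (c F.≟ p) ×-dec ¬? (c F.≟ c₁)))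
    ... | no no-second = one-child-side evp e₁ c₁≢p p-or-c₁ (descend-child f evp r-out fuel c₁ e₁ c₁≢p)
      where
      p-or-c₁ : ∀ z → E v z → z ≡ p ⊎ z ≡ c₁
      p-or-c₁ z ez with z F.≟ p | z F.≟ c₁
      ... | yes z≡p | _ = inj₁ z≡p
      ... | no _ | yes z≡c₁ = inj₂ z≡c₁
      ... | no z≢p | no z≢c₁ = ⊥-elim (no-second (z , ez , z≢p , z≢c₁))
    ... | yes (c₂ , e₂ , c₂≢p , c₂≢c₁) = two-children-side evp e₁ e₂ c₁≢p c₂≢p c₂≢c₁
            (descend-child f evp r-out fuel c₁ e₁ c₁≢p) (descend-child f evp r-out fuel c₂ e₂ c₂≢p)

    descend-child f {v} {p} evp r-out fuel c evc c≢p = descend f c v (E-sym evc) r-out′ fuel′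
      where
      r-out′ : ¬ Side c v r
      r-out′ r-in = r-out (inside-child evp evc c≢p r-in)
      fuel′ : n ≤ d c r + f
      fuel′ = subst (n ≤_) (trans (+-suc (d v r) f) (cong (_+ f) (sym (d-child evp r-out (child-side evp evc c≢p) (E-sym evc))))) fuel

  side-shape : ∀ {v p} → E v p → SideShape v p
  side-shape {v} {p} evp = DescendFrom.descend p n v p evp (not-self-side evp) (m≤n+m n _)

module PathRecognition {n : ℕ} (T : Graph n) (conn : Connected T) (acyc : ¬ HasCycle T) where
  open Descent T conn acyc public

  spreads-everywhere : ∀ (C : Fin n → Set) → (∀ v z → C v → E v z → C z) → ∀ x → C x → ∀ y → C y
  spreads-everywhere C spreads x cx y = along (proj₁ (conn x y)) x cx (fromWalk (proj₂ (conn x y)))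
    where
    along : ∀ m v → C v → Walk v y m → C y
    along zero v cv w = subst C (walk0 w) cv
    along (suc m) v cv w = along m (at w 1) (spreads v (at w 1) cv (headE w)) (tailW w)

  module SequencePath (N : ℕ) (s : ℕ → Fin n)
    (s-inj : ∀ i j → i < N → j < N → s i ≡ s j → i ≡ j)
    (s-onto : ∀ v → Σ ℕ λ i → i < N × s i ≡ v)
    (s-nbrs : ∀ i → i < N → ∀ z → E (s i) z → (suc i < N × z ≡ s (suc i)) ⊎ (Σ ℕ λ i′ → i ≡ suc i′ × z ≡ s i′))
    (s-step : ∀ i → suc i < N → E (s i) (s (suc i))) where

    N≡n : N ≡ n
    N≡n = ≤-antisym (FP.injective⇒≤ {f = λ (i : Fin N) → s (toℕ i)}
                      (λ {i} {j} eq → FP.toℕ-injective (s-inj _ _ (FP.toℕ<n i) (FP.toℕ<n j) eq)))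
                    (injective-decoded⇒≤ N s (λ v → v) (λ eq → eq) s-onto)

    <N : ∀ (i : Fin n) → toℕ i < N
    <N i = subst (toℕ i <_) (sym N≡n) (FP.toℕ<n i)

    to : Fin n → Fin n
    to i = s (toℕ i)

    from : Fin n → Fin n
    from v = fromℕ< (subst (proj₁ (s-onto v) <_) N≡n (proj₁ (proj₂ (s-onto v))))

    to-from : ∀ v → to (from v) ≡ v
    to-from v = trans (cong s (FP.toℕ-fromℕ< _)) (proj₂ (proj₂ (s-onto v)))

    from-to : ∀ i → from (to i) ≡ i
    from-to i = FP.toℕ-injective (trans (FP.toℕ-fromℕ< _)
                  (s-inj _ _ (proj₁ (proj₂ (s-onto (to i)))) (<N i) (proj₂ (proj₂ (s-onto (to i))))))

    is-path : IsPathGraph T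
    is-path = mk↔ₛ′ to from to-from from-to , λ i j → adjacent⇒consecutive i j , consecutive⇒adjacent i j
      where
      adjacent⇒consecutive : ∀ i j → E (to i) (to j) → toℕ j ≡ suc (toℕ i) ⊎ toℕ i ≡ suc (toℕ j)
      adjacent⇒consecutive i j e with s-nbrs (toℕ i) (<N i) (to j) e
      ... | inj₁ (h , eq) = inj₁ (s-inj _ _ (<N j) h eq)
      ... | inj₂ (i′ , i≡ , eq) = inj₂ (trans i≡ (cong suc (sym (s-inj _ _ (<N j) (≤-trans (n≤1+n _) (subst (_< N) i≡ (<N i))) eq))))
      consecutive⇒adjacent : ∀ i j → toℕ j ≡ suc (toℕ i) ⊎ toℕ i ≡ suc (toℕ j) → E (to i) (to j)
      consecutive⇒adjacent i j (inj₁ eq) = subst (λ v → E (to i) (s v)) (sym eq) (s-step (toℕ i) (subst (_< N) eq (<N j)))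
      consecutive⇒adjacent i j (inj₂ eq) = E-sym (subst (λ v → E (to j) (s v)) (sym eq) (s-step (toℕ j) (subst (_< N) eq (<N i))))

  -- Two disjoint legs L (of e) and L′ (of e′) glued along the edge
  -- ℓ 0 = e′ – e = ℓ′ 0 make up the whole tree, which is therefore the path
  -- ℓ t, …, ℓ 0, ℓ′ 0, …, ℓ′ t′.
  module GluedLegs {e e′ : Fin n} {t t′ : ℕ} (L : Leg e (suc t)) (L′ : Leg e′ (suc t′))
                   (e≡ : e ≡ Leg.ℓ L′ 0) (e′≡ : e′ ≡ Leg.ℓ L 0)
                   (disjoint : ∀ i j → i < suc t → j < suc t′ → Leg.ℓ L i ≢ Leg.ℓ L′ j) where
    ℓ ℓ′ : ℕ → Fin n
    ℓ = Leg.ℓ L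
    ℓ′ = Leg.ℓ L′
    N : ℕ
    N = suc t + suc t′

    s : ℕ → Fin n
    s = splice (suc t) (λ k → ℓ (t ∸ k)) ℓ′

    on-L : ∀ k → k < suc t → s k ≡ ℓ (t ∸ k)
    on-L = splice-l (suc t) (λ k → ℓ (t ∸ k)) ℓ′

    on-L′ : ∀ j → s (suc t + j) ≡ ℓ′ j
    on-L′ = splice-r (suc t) (λ k → ℓ (t ∸ k)) ℓ′

    L′-index : ∀ {j} → suc t + j < N → j < suc t′
    L′-index h = +-cancelˡ-< (suc t) _ _ h

    s-inj : ∀ i j → i < N → j < N → s i ≡ s j → i ≡ j
    s-inj i j hi hj eq with split-< (suc t) i | split-< (suc t) j
    ... | inj₁ i< | inj₁ j< = rev-inj t i j i< j< (LegFacts.leg-inj L _ _ (rev-< t i) (rev-< t j)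
                                 (trans (sym (on-L i i<)) (trans eq (on-L j j<))))
    ... | inj₁ i< | inj₂ (j′ , refl) = ⊥-elim (disjoint _ j′ (rev-< t i) (L′-index hj) (trans (sym (on-L i i<)) (trans eq (on-L′ j′))))
    ... | inj₂ (i′ , refl) | inj₁ j< = ⊥-elim (disjoint _ i′ (rev-< t j) (L′-index hi) (trans (sym (on-L j j<)) (trans (sym eq) (on-L′ i′))))
    ... | inj₂ (i′ , refl) | inj₂ (j′ , refl) = cong (suc t +_) (LegFacts.leg-inj L′ i′ j′ (L′-index hi) (L′-index hj)
            (trans (sym (on-L′ i′)) (trans eq (on-L′ j′))))

    s-last-of-L : s t ≡ ℓ 0
    s-last-of-L = trans (on-L t ≤-refl) (cong ℓ (n∸n≡0 t))

    s-first-of-L′ : s (suc t) ≡ ℓ′ 0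
    s-first-of-L′ = trans (cong s (sym (+-identityʳ (suc t)))) (on-L′ 0)

    Neighbours : ℕ → Fin n → Set
    Neighbours i z = (suc i < N × z ≡ s (suc i)) ⊎ (Σ ℕ λ i′ → i ≡ suc i′ × z ≡ s i′)

    -- The predecessor of ℓ (t ∸ i) on L is s (i + 1): for i = t it is
    -- e = ℓ′ 0 = s (t + 1).
    pred-on-L : ∀ i → i < suc t → ∀ m → t ∸ i ≡ m → suc i < N × prev e ℓ m ≡ s (suc i)
    pred-on-L i i< zero t∸i≡0 = subst (λ v → suc v < N) (sym i≡t) (s≤s (subst (suc t ≤_) (sym (+-suc t t′)) (s≤s (m≤m+n t t′)))) ,
                                trans e≡ (trans (sym s-first-of-L′) (cong (λ v → s (suc v)) (sym i≡t)))
      where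
      i≡t : i ≡ t
      i≡t = rev≡0 t i i< t∸i≡0
    pred-on-L i i< (suc a) t∸i≡1+a = ≤-trans (proj₁ next) (m≤m+n (suc t) (suc t′)) ,
                                     trans (cong ℓ (sym (proj₂ next))) (sym (on-L (suc i) (proj₁ next)))
      where
      next : suc i < suc t × t ∸ suc i ≡ a
      next = rev≡suc t i a t∸i≡1+a

    nbrs-on-L : ∀ i → i < suc t → ∀ z → E (ℓ (t ∸ i)) z → Neighbours i z
    nbrs-on-L i i< z ez with Leg.neighbours L (t ∸ i) (rev-< t i) z ez
    ... | inj₁ q = inj₁ (proj₁ pred , trans q (proj₂ pred))
      where
      pred : suc i < N × prev e ℓ (t ∸ i) ≡ s (suc i)
      pred = pred-on-L i i< (t ∸ i) refl
    ... | inj₂ (h , q) with rev-suc t i i< h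
    ... | k′ , refl , t∸k′ = inj₂ (k′ , refl , trans q (trans (cong ℓ (sym t∸k′)) (sym (on-L k′ (≤-trans (n≤1+n _) i<)))))

    nbrs-on-L′ : ∀ j → suc t + j < N → ∀ z → E (ℓ′ j) z → Neighbours (suc t + j) z
    nbrs-on-L′ j h z ez with Leg.neighbours L′ j (L′-index h) z ez
    nbrs-on-L′ zero h z ez | inj₁ q = inj₂ (t , +-identityʳ (suc t) , trans q (trans e′≡ (sym s-last-of-L)))
    nbrs-on-L′ (suc j) h z ez | inj₁ q = inj₂ (suc t + j , +-suc (suc t) j , trans q (sym (on-L′ j)))
    nbrs-on-L′ j h z ez | inj₂ (h′ , q) = inj₁ (subst (_< N) (+-suc (suc t) j) (+-monoʳ-< (suc t) h′) ,
            trans q (trans (sym (on-L′ (suc j))) (cong s (+-suc (suc t) j))))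

    s-nbrs : ∀ i → i < N → ∀ z → E (s i) z → Neighbours i z
    s-nbrs i hi z ez with split-< (suc t) i
    ... | inj₁ i< = nbrs-on-L i i< z (subst (λ v → E v z) (on-L i i<) ez)
    ... | inj₂ (j , refl) = nbrs-on-L′ j hi z (subst (λ v → E v z) (on-L′ j) ez)

    s-step : ∀ i → suc i < N → E (s i) (s (suc i))
    s-step i h with split-< (suc t) i
    s-step i h | inj₁ i< with m≤n⇒m<n∨m≡n (s≤s⁻¹ i<)
    ... | inj₁ i<t = subst₂ E (sym (trans (on-L i i<) (cong ℓ t∸i))) (sym (on-L (suc i) (s≤s i<t)))
                       (Leg.to-prev L (suc (t ∸ suc i)) (subst (_< suc t) t∸i (rev-< t i)))
      where
      t∸i : t ∸ i ≡ suc (t ∸ suc i)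
      t∸i = +-∸-assoc 1 i<t
    ... | inj₂ refl = subst₂ E (sym s-last-of-L) (sym s-first-of-L′) (subst (E (ℓ 0)) e≡ (Leg.to-prev L 0 (s≤s z≤n)))
    s-step i h | inj₂ (j , refl) = subst₂ E (sym (on-L′ j)) (trans (sym (on-L′ (suc j))) (cong s (+-suc (suc t) j)))
       (E-sym (Leg.to-prev L′ (suc j) (+-cancelˡ-≤ (suc t) _ _
         (subst (_≤ N) (sym (trans (+-suc (suc t) (suc j)) (cong suc (+-suc (suc t) j)))) h))))

    -- The listed vertices are closed under adjacency, hence are all vertices.
    s-onto : ∀ v → Σ ℕ λ i → i < N × s i ≡ v
    s-onto = spreads-everywhere (λ v → Σ ℕ λ i → i < N × s i ≡ v) spreads (s 0) (0 , s≤s z≤n , refl)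
      where
      spreads : ∀ v z → (Σ ℕ λ i → i < N × s i ≡ v) → E v z → Σ ℕ λ i → i < N × s i ≡ z
      spreads v z (i , hi , refl) ez with s-nbrs i hi z ez
      ... | inj₁ (h , q) = suc i , h , sym q
      ... | inj₂ (i′ , refl , q) = i′ , ≤-trans (n≤1+n _) hi , sym q

    is-path : IsPathGraph T
    is-path = SequencePath.is-path N s s-inj s-onto s-nbrs s-step

module LowerBound {n : ℕ} (T : Graph n) (conn : Connected T) (acyc : ¬ HasCycle T)
                  (not-path : ¬ IsPathGraph T) where
  open PathRecognition T conn acyc public

  IsMajor? : ∀ v → Dec (IsMajor T v)
  IsMajor? v with FP.any? (λ a → FP.any? (λ b → FP.any? (λ c →
      E? v a ×-dec E? v b ×-dec E? v c ×-dec ¬? (a F.≟ b) ×-dec ¬? (a F.≟ c) ×-dec ¬? (b F.≟ c))))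
  ... | yes (a , b , c , h) = yes (a , b , c , h)
  ... | no none = no (λ (a , b , c , h) → none (a , b , c , h))

  Resolves : Fin n → Fin n → Fin n → Set
  Resolves x y z = d z x ≢ d z y

  ResolvingFork : Fin n → Fin n → Set
  ResolvingFork x y = Σ Fork λ F → ∀ i → i < ForkFacts.span F → Resolves x y (ForkFacts.vertex F i)

  fork-within-resolving : ∀ {x y} (S : Fin n → Set) → (∀ {z} → S z → Resolves x y z) →
                          Σ Fork (ForkWithin S) → ResolvingFork x y
  fork-within-resolving S resolves (F , in₁ , in₂) = F , resolved
    where
    resolved : ∀ i → i < ForkFacts.span F → Resolves _ _ (ForkFacts.vertex F i)
    resolved i h with ForkFacts.vertex-on-legs F i h
    ... | inj₁ (j , hj , eq) = subst (Resolves _ _) (sym eq) (resolves (in₁ j hj))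
    ... | inj₂ (j , hj , eq) = subst (Resolves _ _) (sym eq) (resolves (in₂ j hj))

  side-closer : ∀ {a b x y} → E a b → d a y ≡ suc (d b y) → d a x ≤ d b y → ∀ {z} → Side a b z → d z x < d z y
  side-closer {a} {b} {x} {y} eab ay ax {z} z-in = subst (d z x <_) (sym (across-edge eab y-out z-in))
      (≤-<-trans (d-tri z a x) (+-monoʳ-< (d z a) (s≤s ax)))
    where
    y-out : ¬ Side a b y
    y-out h = 1+n≰n (≤-trans (n≤1+n _) (subst (λ v → suc v ≤ d y b) d-ya h))
      where
      d-ya : d y a ≡ suc (d y b)
      d-ya = trans (d-sym y a) (trans ay (cong suc (d-sym b y)))

  module Separated {x y : Fin n} (Sx Sy : Fin n → Set)
                   (closer-x : ∀ {z} → Sx z → d z x < d z y) (closer-y : ∀ {z} → Sy z → d z y < d z x) where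
    resolves-x : ∀ {z} → Sx z → Resolves x y z
    resolves-x z-in = <⇒≢ (closer-x z-in)

    resolves-y : ∀ {z} → Sy z → Resolves x y z
    resolves-y z-in eq = <⇒≢ (closer-y z-in) (sym eq)

    apart : ∀ {z} → Sx z → Sy z → ⊥
    apart p q = <-asym (closer-x p) (closer-y q)

  -- Midpoint edge a – b: the side of a is closer to x, the side of b to y.
  -- A fork in either side resolves x and y; two legs would make T a path.
  resolving-at-edge : ∀ {x y a b} → E a b → (∀ {z} → Side a b z → d z x < d z y) →
                      (∀ {z} → Side b a z → d z y < d z x) → ResolvingFork x y
  resolving-at-edge {x} {y} {a} {b} eab closer-x closer-y = combine (side-shape eab) (side-shape (E-sym eab))
    where
    open Separated {x} {y} (Side a b) (Side b a) closer-x closer-y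
    combine : SideShape a b → SideShape b a → ResolvingFork x y
    combine (has-fork F within) _ = fork-within-resolving (Side a b) resolves-x (F , within)
    combine (is-leg _ _ _ _) (has-fork F within) = fork-within-resolving (Side b a) resolves-y (F , within)
    combine (is-leg t₁ L₁ start₁ within₁) (is-leg t₂ L₂ start₂ within₂) =
      ⊥-elim (not-path (GluedLegs.is-path L₁ L₂ (sym start₂) (sym start₁) legs-disjoint))
      where
      legs-disjoint : ∀ i j → i < suc t₁ → j < suc t₂ → Leg.ℓ L₁ i ≢ Leg.ℓ L₂ j
      legs-disjoint i j hi hj eq = apart (within₁ i hi) (subst (Side b a) (sym eq) (within₂ j hj))

  -- Forks in the sides resolve x and y; two legs form a fork at m if m is
  -- major, and otherwise (m then has degree two) T would be a path.
  resolving-at-vertex : ∀ {x y a₁ m a₂} → E a₁ m → E a₂ m → (∀ {z} → Side a₁ m z → d z x < d z y) →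
                        (∀ {z} → Side a₂ m z → d z y < d z x) → ResolvingFork x y
  resolving-at-vertex {x} {y} {a₁} {m} {a₂} e₁ e₂ closer-x closer-y = combine (side-shape e₁) (side-shape e₂)
    where
    open Separated {x} {y} (Side a₁ m) (Side a₂ m) closer-x closer-y
    combine : SideShape a₁ m → SideShape a₂ m → ResolvingFork x y
    combine (has-fork F within) _ = fork-within-resolving (Side a₁ m) resolves-x (F , within)
    combine (is-leg _ _ _ _) (has-fork F within) = fork-within-resolving (Side a₂ m) resolves-y (F , within)
    combine (is-leg t₁ L₁ start₁ within₁) (is-leg t₂ L₂ start₂ within₂) with IsMajor? m
    ... | yes m-major = fork-within-resolving (λ z → Side a₁ m z ⊎ Side a₂ m z) resolves
                          (mkFork m m-major t₁ t₂ L₁ L₂ ends-differ , (λ i h → inj₁ (within₁ i h)) , (λ i h → inj₂ (within₂ i h)))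
      where
      resolves : ∀ {z} → Side a₁ m z ⊎ Side a₂ m z → Resolves x y z
      resolves (inj₁ z-in) = resolves-x z-in
      resolves (inj₂ z-in) = resolves-y z-in
      ends-differ : Leg.ℓ L₁ t₁ ≢ Leg.ℓ L₂ t₂
      ends-differ eq = apart (within₁ t₁ ≤-refl) (subst (Side a₂ m) (sym eq) (within₂ t₂ ≤-refl))
    ... | no m-minor = ⊥-elim (not-path (GluedLegs.is-path L₁ L₂′ refl (sym start₁) legs-disjoint))
      where
      a₁≢a₂ : a₁ ≢ a₂
      a₁≢a₂ eq = apart (self-side e₁) (subst (Side a₂ m) (sym eq) (self-side e₂))
      L₂-avoids-a₁ : ∀ i → i < suc t₂ → Leg.ℓ L₂ i ≢ a₁
      L₂-avoids-a₁ i h eq = apart (subst (Side a₁ m) (sym eq) (self-side e₁)) (within₂ i h)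
      L₂′ : Leg a₁ (suc (suc t₂))
      L₂′ = extend-leg (E-sym e₁) L₂ start₂ (degree≤2 m-minor (E-sym e₁) (E-sym e₂) a₁≢a₂) L₂-avoids-a₁
      legs-disjoint : ∀ i j → i < suc t₁ → j < suc (suc t₂) → Leg.ℓ L₁ i ≢ Leg.ℓ L₂′ j
      legs-disjoint i zero hi hj eq = not-self-side e₁ (subst (Side a₁ m) eq (within₁ i hi))
      legs-disjoint i (suc j) hi hj eq = apart (within₁ i hi) (subst (Side a₂ m) (sym eq) (within₂ j (s≤s⁻¹ hj)))

  -- Cut a shortest x–y walk γ in its middle: at the edge γ i – γ (i + 1)
  -- if d x y = 2i + 1, at the vertex γ (i + 1) if d x y = 2i + 2.
  module Midpoint (x y : Fin n) where
    D : ℕ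
    D = d x y
    γ : Walk x y D
    γ = geodesic x y
    open Geodesic γ

    d-x : ∀ k → k ≤ D → d (at γ k) x ≡ k
    d-x k h = trans (d-sym _ _) (d-start k h)

    odd : ∀ i → D ≡ suc (i + i) → ResolvingFork x y
    odd i D≡ = resolving-at-edge edge
      (side-closer edge (trans (d-end i (<⇒≤ i+1≤)) (trans (+-∸-assoc 1 i+1≤) (cong suc (sym (d-end (suc i) i+1≤)))))
                   (≤-reflexive (trans (d-x i (<⇒≤ i+1≤)) (sym d-y))))
      (side-closer (E-sym edge) (trans (d-x (suc i) i+1≤) (cong suc (sym (d-x i (<⇒≤ i+1≤)))))
                   (≤-reflexive (trans d-y (sym (d-x i (<⇒≤ i+1≤))))))
      where
      i+1≤ : suc i ≤ D
      i+1≤ = subst (suc i ≤_) (sym D≡) (s≤s (m≤m+n i i))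
      edge : E (at γ i) (at γ (suc i))
      edge = step γ i i+1≤
      d-y : d (at γ (suc i)) y ≡ i
      d-y = trans (d-end (suc i) i+1≤) (trans (cong (_∸ suc i) D≡) (m+n∸m≡n i i))

    even : ∀ i → D ≡ suc (suc (i + i)) → ResolvingFork x y
    even i D≡ = resolving-at-vertex e₁ e₂
      (side-closer e₁ (trans (d-end i (<⇒≤ i+1≤)) (trans (+-∸-assoc 1 i+1≤) (cong suc (sym (d-end (suc i) i+1≤)))))
                   (subst (_≤ d (at γ (suc i)) y) (sym (d-x i (<⇒≤ i+1≤))) i≤d-my))
      (side-closer e₂ (trans (d-x (suc (suc i)) i+2≤) (cong suc (sym (d-x (suc i) i+1≤))))
                   (subst₂ _≤_ (sym d-a₂y) (sym (d-x (suc i) i+1≤)) (n≤1+n i)))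
      where
      i+2≤ : suc (suc i) ≤ D
      i+2≤ = subst (suc (suc i) ≤_) (sym D≡) (s≤s (s≤s (m≤m+n i i)))
      i+1≤ : suc i ≤ D
      i+1≤ = <⇒≤ i+2≤
      e₁ : E (at γ i) (at γ (suc i))
      e₁ = step γ i i+1≤
      e₂ : E (at γ (suc (suc i))) (at γ (suc i))
      e₂ = E-sym (step γ (suc i) i+2≤)
      i≤d-my : i ≤ d (at γ (suc i)) y
      i≤d-my = subst (i ≤_) (sym (trans (d-end (suc i) i+1≤) (cong (_∸ suc i) D≡)))
                 (subst (_≤ suc (i + i) ∸ i) (m+n∸m≡n i i) (∸-monoˡ-≤ i (n≤1+n (i + i))))
      d-a₂y : d (at γ (suc (suc i))) y ≡ i
      d-a₂y = trans (d-end (suc (suc i)) i+2≤) (trans (cong (_∸ suc (suc i)) D≡) (m+n∸m≡n i i))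

  resolving-fork : ∀ x y → x ≢ y → ResolvingFork x y
  resolving-fork x y x≢y with d x y in d≡ | d-pos x≢y
  ... | suc D′ | _ with parity D′
  ... | i , inj₁ D′≡ = Midpoint.odd x y i (trans d≡ (cong suc D′≡))
  ... | i , inj₂ D′≡ = Midpoint.even x y i (trans d≡ (cong suc D′≡))

module Dimensionality {n : ℕ} (T : Graph n) (conn : Connected T) (acyc : ¬ HasCycle T)
                      (not-path : ¬ IsPathGraph T) where
  open LowerBound T conn acyc not-path public

  HasDegreeOne? : ∀ u → Dec (HasDegreeOne T u)
  HasDegreeOne? u = FP.any? (λ z → E? u z ×-dec FP.all? (λ z′ → E? u z′ →-dec (z′ F.≟ z)))

  IsTerminal? : ∀ u v → Dec (IsTerminal T u v)
  IsTerminal? u v with IsMajor? v | HasDegreeOne? u | FP.all? (λ w → IsMajor? w →-dec (¬? (w F.≟ v) →-dec (d u v <? d u w)))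
  ... | yes v-major | yes u-deg | yes closest = yes (v-major , u-deg , λ w w-major w≢v a b da db →
                                      subst₂ _<_ (sym (Dist⇒≡d da)) (sym (Dist⇒≡d db)) (closest w w-major w≢v))
  ... | no ¬major | _ | _ = no (λ u-term → ¬major (proj₁ u-term))
  ... | yes _ | no ¬deg | _ = no (λ u-term → ¬deg (proj₁ (proj₂ u-term)))
  ... | yes _ | yes _ | no ¬closest = no (λ u-term → ¬closest (λ w w-major w≢v →
                                        proj₂ (proj₂ u-term) w w-major w≢v _ _ (Dist-d u v) (Dist-d u w)))

  TerminalPair : Fin n → Fin n → Fin n → Set
  TerminalPair w u u′ = u ≢ u′ × IsTerminal T u w × IsTerminal T u′ w

  TerminalPair? : ∀ w u u′ → Dec (TerminalPair w u u′)
  TerminalPair? w u u′ = ¬? (u F.≟ u′) ×-dec IsTerminal? u w ×-dec IsTerminal? u′ w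

  -- The legs towards u and u′ form a fork, so ς(u, u′) = d u w + d w u′,
  -- and this number bounds every k-metric generator.
  terminal-pair : ∀ {w u u′} → TerminalPair w u u′ →
                  VarsigmaPair T u u′ w (d u w + d w u′) × (∀ k S → IsKMetricGenerator T k S → k ≤ d u w + d w u′)
  terminal-pair {w} (u≢u′ , u-term , u′-term) with terminal⇒leg u-term | terminal⇒leg u′-term
  ... | t₁ , L₁ , refl | t₂ , L₂ , refl =
    subst (VarsigmaPair T _ _ w) d-ends (between⇒varsigma d-ends) ,
    λ k S gen → subst (k ≤_) span≡ (span-bound k S gen)
    where open ForkFacts (mkFork w (proj₁ u-term) t₁ t₂ L₁ L₂ u≢u′)

  all-vertices-generator : ∀ k → (∀ F → k < ForkFacts.span F) → IsKMetricGenerator T (suc k) ⊤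
  all-vertices-generator k spans x y x≢y with resolving-fork x y x≢y
  ... | F , resolved = f , f-inj , λ i → ∈⊤ , d x (f i) , d y (f i) , Dist-d x (f i) , Dist-d y (f i) ,
                         λ eq → resolved (toℕ i) (below i) (trans (d-sym _ x) (trans eq (d-sym y _)))
    where
    open ForkFacts F using (vertex; vertex-inj)
    below : ∀ (i : Fin (suc k)) → toℕ i < ForkFacts.span F
    below i = ≤-trans (FP.toℕ<n i) (spans F)
    f : Fin (suc k) → Fin n
    f i = vertex (toℕ i)
    f-inj : Injective _≡_ _≡_ f
    f-inj {i} {j} eq = FP.toℕ-injective (vertex-inj (toℕ i) (toℕ j) (below i) (below j) eq)

  module OfDimension (k : ℕ) (generator : ∃[ S ] IsKMetricGenerator T k S)
                     (maximal : ∀ k′ → ∃[ S ] IsKMetricGenerator T k′ S → k′ ≤ k) where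

    k≤pair : ∀ {w u u′ l} → TerminalPair w u u′ → VarsigmaPair T u u′ w l → k ≤ l
    k≤pair pair ς with terminal-pair pair
    ... | ς′ , bound = subst (k ≤_) (least-unique ς′ ς) (bound k (proj₁ generator) (proj₂ generator))

    -- Some terminal pair has ς-value at most k: otherwise every fork would
    -- span more than k, contradicting the maximality of k.
    short-pair : Σ (Fin n) λ w → Σ (Fin n) λ u → Σ (Fin n) λ u′ → TerminalPair w u u′ × d u w + d w u′ ≤ k
    short-pair with FP.any? (λ w → FP.any? (λ u → FP.any? (λ u′ → TerminalPair? w u u′ ×-dec (d u w + d w u′ ≤? k))))
    ... | yes found = found
    ... | no none = ⊥-elim (1+n≰n (maximal (suc k) (⊤ , all-vertices-generator k spans)))
      where
      spans : ∀ F → k < ForkFacts.span F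
      spans F = ≰⇒> λ span≤k → none (centre , u₁ , u₂ , (ends-differ , u₁-terminal , u₂-terminal) , subst (_≤ k) span≡ span≤k)
        where
        open Fork F
        open ForkFacts F

    varsigma-from-short-pair : (Σ (Fin n) λ w → Σ (Fin n) λ u → Σ (Fin n) λ u′ → TerminalPair w u u′ × d u w + d w u′ ≤ k) →
                               Varsigma T k
    varsigma-from-short-pair (w , u , u′ , pair@(u≢u′ , u-term , u′-term) , ≤k) =
      (w , (proj₁ u-term , u , u′ , pair) , ((u , u′ , u≢u′ , u-term , u′-term , ς-k) , minimal-at-w)) , minimal
      where
      ς-k : VarsigmaPair T u u′ w k
      ς-k = subst (VarsigmaPair T u u′ w) (≤-antisym ≤k (k≤pair pair (proj₁ (terminal-pair pair)))) (proj₁ (terminal-pair pair))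
      minimal-at-w : ∀ l → (∃[ v ] ∃[ v′ ] (v ≢ v′ × IsTerminal T v w × IsTerminal T v′ w × VarsigmaPair T v v′ w l)) → k ≤ l
      minimal-at-w l (_ , _ , v≢v′ , v-term , v′-term , ς) = k≤pair (v≢v′ , v-term , v′-term) ς
      minimal : ∀ l → (∃[ w′ ] (InM T w′ × VarsigmaVertex T w′ l)) → k ≤ l
      minimal l (_ , _ , (_ , _ , v≢v′ , v-term , v′-term , ς) , _) = k≤pair (v≢v′ , v-term , v′-term) ς

theorem24 : ∀ (n : ℕ) (T : Graph n) (k : ℕ) → IsTree T → ¬ IsPathGraph T →
    IsKMetricDimensional T k → Varsigma T k
theorem24 n T k (conn , acyc) not-path (generator , maximal) = varsigma-from-short-pair short-pair
  where open Dimensionality.OfDimension T conn acyc not-path k generator maximal
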